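{- Let $n\ge1$ and $k\ge 0$ with $2k\le 3n$, let $s$ be the sign string consisting of $k$ minuses followed by $3n-2k$ pluses, and let $T_s$ be a filling of content $s$. Then the boundary sign string of the web $w_{T_s}$ is $s$.
   Context: A sign string is a finite word in $\{+,-\}$. A filling of content $s$ is a semistandard Young tableau (rows weakly increasing, columns strictly increasing) of shape $(3,\dots,3)$ with $n$ rows, in which each of $1,\dots,k$ appears exactly twice and each of $k+1,\dots,3n-k$ exactly once. $\widetilde{T_s}$ is the standard tableau obtained by replacing, for $i\le k$, the leftmost occurrence of $i$ by $2i-1$ and the rightmost by $2i$, and each $i>k$ by $i+k$; $\widetilde{T_s}'$ is its conjugate (transpose), a standard tableau of shape $(n,n,n)$. Webs: a web is a finite oriented graph embedded in the closed upper half-plane whose vertices on the boundary line (boundary vertices, numbered left to right) are univalent, whose other vertices (internal) are trivalent, each internal vertex being a source (all edges outward) or a sink (all edges inward). Its boundary sign string has $j$-th letter $+$ if the edge at boundary vertex $j$ is oriented away from it and $-$ if toward it. Tymoczko's web $w_T$ of a standard tableau $T$ of shape $(n,n,n)$: place points $1,\dots,3n$ on a line; for the middle-row entries $j$ in increasing order draw a semicircular arc above the line from $j$ to the largest top-row entry $i<j$ not yet so joined (left arcs); then for the bottom-row entries $k$ in increasing order draw an arc from $k$ to the largest middle-row entry $j<k$ not yet joined to a bottom-row entry (right arcs). Then replace a neighbourhood of each middle-row point $j$ by a Y (an edge from $j$ up to a new internal vertex from which the two arcs emanate), orient all edges away from the boundary points (boundary points are sources, Y branch points sinks), and replace each crossing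 of a left and right arc by two trivalent vertices joined by a new edge (incoming half-edges meet at a new sink, outgoing half-edges at a new source, new edge oriented source to sink). The web $w_{T_s}$: in $w_{\widetilde{T_s}'}$, for each $1\le i\le k$ the boundary vertices $2i-1$ and $2i$ are adjacent to a common internal vertex $v_i$; $w_{T_s}$ is obtained by contracting the two boundary edges at $2i-1$ and $2i$ for each $i\le k$, i.e. deleting these boundary vertices and their edges and making $v_i$ a boundary vertex (placed on the boundary line in their position). -}

module Defs where

open import Data.Nat as ℕ using (ℕ; zero; suc; _+_; _*_; _∸_; _≤_; _<_; _≤ᵇ_; _<ᵇ_; _≡ᵇ_)
open import Data.Integer as ℤ using (ℤ; +_)
open import Data.Fin as Fin using (Fin; toℕ)
open import Data.List as List using (List; []; _∷_; map; filter; length; upTo; allFin; concatMap; foldr; replicate; _++_)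
open import Data.Bool.ListAction using (any)
open import Data.Maybe using (Maybe; just; nothing; _>>=_)
open import Data.Product using (_×_; _,_; proj₁; proj₂)
open import Data.Bool using (Bool; true; false; if_then_else_; _∧_; _∨_; not)
open import Relation.Binary.PropositionalEquality using (_≡_)

data Sign : Set where
  plus minus : Sign

signStr : ℕ → ℕ → List Sign
signStr n k = replicate k minus ++ replicate (3 * n ∸ 2 * k) plus

range1 : ℕ → List ℕ
range1 N = map suc (upTo N)

filterB : {A : Set} → (A → Bool) → List A → List A
filterB p []       = []
filterB p (x ∷ xs) = if p x then x ∷ filterB p xs else filterB p xs

-- Fillings: a tableau of shape (3,...,3) with n rows is a function
-- (row : Fin n) → (column : Fin 3) → entry.

Tab3 : ℕ → Set
Tab3 n = Fin n → Fin 3 → ℕ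

cells : (n : ℕ) → List (Fin n × Fin 3)
cells n = concatMap (λ r → map (λ c → (r , c)) (allFin 3)) (allFin n)

countVal : {n : ℕ} → Tab3 n → ℕ → ℕ
countVal {n} F v = length (filterB (λ rc → F (proj₁ rc) (proj₂ rc) ≡ᵇ v) (cells n))

-- prescribed multiplicity of v in content s (k minuses, 3n-2k pluses):
-- 1..k twice, k+1..3n-k once, nothing else
contentMult : ℕ → ℕ → ℕ → ℕ
contentMult n k v =
  if (1 ≤ᵇ v) ∧ (v ≤ᵇ k) then 2
  else if (k <ᵇ v) ∧ (v ≤ᵇ 3 * n ∸ k) then 1
  else 0

record IsFilling (n k : ℕ) (F : Tab3 n) : Set where
  field
    rowsWeak   : ∀ (r : Fin n) (c c′ : Fin 3) → toℕ c ≤ toℕ c′ → F r c ≤ F r c′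
    colsStrict : ∀ (r r′ : Fin n) (c : Fin 3) → toℕ r < toℕ r′ → F r c < F r′ c
    content    : ∀ (v : ℕ) → countVal F v ≡ contentMult n k v

-- \tilde{T_s}: value i ≤ k at its leftmost occurrence ↦ 2i-1, at its
-- rightmost occurrence ↦ 2i; value i > k ↦ i + k.
-- An occurrence of i in column c is the leftmost one iff an occurrence of i
-- exists in a column strictly to the right of c.
tildeT : {n : ℕ} → ℕ → Tab3 n → Tab3 n
tildeT {n} k F r c =
  if F r c ≤ᵇ k
  then (if any (λ rc → (F (proj₁ rc) (proj₂ rc) ≡ᵇ F r c) ∧ (toℕ c <ᵇ toℕ (proj₂ rc))) (cells n)
        then 2 * F r c ∸ 1
        else 2 * F r c)
  else F r c + k

-- a tableau of shape (n,n,n): (row : Fin 3) → (column : Fin n) → entry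
Tab3' : ℕ → Set
Tab3' n = Fin 3 → Fin n → ℕ

conj : {n : ℕ} → Tab3 n → Tab3' n
conj F c r = F r c

-- vertices: boundary vertex j (numbered 1,2,... from the left),
-- Y-vertex at the middle-row point j, and the sink / source created at the
-- crossing of the left arc with middle endpoint b and the right arc with
-- middle endpoint c.
data V : Set where
  bd  : ℕ → V
  yv  : ℕ → V
  snk : ℕ → ℕ → V
  src : ℕ → ℕ → V

_==V_ : V → V → Bool
bd a    ==V bd b    = a ≡ᵇ b
yv a    ==V yv b    = a ≡ᵇ b
snk a b ==V snk c d = (a ≡ᵇ c) ∧ (b ≡ᵇ d)
src a b ==V src c d = (a ≡ᵇ c) ∧ (b ≡ᵇ d)
_ ==V _ = false

isBd : V → Bool
isBd (bd _) = true
isBd _      = false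

-- an oriented graph: number of boundary vertices and the list of oriented
-- edges (tail , head)
record Web : Set where
  constructor mkWeb
  field
    nbd   : ℕ
    edges : List (V × V)
open Web public

signAt : Web → ℕ → Maybe Sign
signAt w j = foldr step nothing (edges w)
  where
  step : V × V → Maybe Sign → Maybe Sign
  step (x , y) acc =
    if x ==V bd j then just plus
    else if y ==V bd j then just minus
    else acc

boundarySigns : Web → List (Maybe Sign)
boundarySigns w = map (signAt w) (range1 (nbd w))

memb : ℕ → List ℕ → Bool
memb x xs = any (λ y → x ≡ᵇ y) xs

maxM : Maybe ℕ → ℕ → Maybe ℕ
maxM nothing  i = just i
maxM (just m) i = just (if m <ᵇ i then i else m)

largestBelow : ℕ → List ℕ → Maybe ℕ
largestBelow j xs = foldr (λ i acc → if i <ᵇ j then maxM acc i else acc) nothing xs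

removeN : ℕ → List ℕ → List ℕ
removeN i xs = filterB (λ x → not (x ≡ᵇ i)) xs

matchArcs : List ℕ → List ℕ → Maybe (List (ℕ × ℕ))
matchArcs cands []       = just []
matchArcs cands (j ∷ js) =
  largestBelow j cands >>= λ i →
  matchArcs (removeN i cands) js >>= λ rest →
  just ((i , j) ∷ rest)

-- left arc (a,b) (a top, b middle) and right arc (c,d) (c middle,
-- d bottom), drawn as semicircles, cross iff their endpoints interleave
crosses : ℕ × ℕ → ℕ × ℕ → Bool
crosses (a , b) (c , d) =
  ((a <ᵇ c) ∧ (c <ᵇ b) ∧ (b <ᵇ d)) ∨ ((c <ᵇ a) ∧ (a <ᵇ d) ∧ (d <ᵇ b))

-- x-coordinate of the crossing of the semicircles over [a,b] and [c,d]:
-- (cd - ab) / ((c+d) - (a+b)), as a fraction with positive denominator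
crossX : ℕ × ℕ → ℕ × ℕ → ℤ × ℤ
crossX (a , b) (c , d) =
  let num = ℤ._-_ (+ (c * d)) (+ (a * b))
      den = ℤ._-_ (+ (c + d)) (+ (a + b))
  in if den ℤ.≤ᵇ ℤ.0ℤ then (ℤ.- num , ℤ.- den) else (num , den)

ltX : ℤ × ℤ → ℤ × ℤ → Bool
ltX (n₁ , d₁) (n₂ , d₂) = not ((n₂ ℤ.* d₁) ℤ.≤ᵇ (n₁ ℤ.* d₂))

selectMin : {A : Set} → (A → A → Bool) → List A → Maybe A
selectMin lt = foldr step nothing
  where
  step : _ → _ → _
  step x nothing  = just x
  step x (just y) = just (if lt x y then x else y)

-- edges along the left arc L = (a,b), oriented from the boundary point a
-- to the Y-vertex at b, cut at its crossings (ordered by increasing x)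
leftArcEdges : List (ℕ × ℕ) → ℕ × ℕ → List (V × V)
leftArcEdges rights (a , b) =
  (bd a , target (selectMin lt crs)) ∷
  map (λ R → (src b (proj₁ R) , target (selectMin lt (filterB (λ R′ → lt R R′) crs)))) crs
  where
  crs = filterB (λ R → crosses (a , b) R) rights
  lt : ℕ × ℕ → ℕ × ℕ → Bool
  lt R R′ = ltX (crossX (a , b) R) (crossX (a , b) R′)
  target : Maybe (ℕ × ℕ) → V
  target nothing  = yv b
  target (just R) = snk b (proj₁ R)

-- edges along the right arc R = (c,d), oriented from the boundary point d
-- to the Y-vertex at c, cut at its crossings (ordered by decreasing x)
rightArcEdges : List (ℕ × ℕ) → ℕ × ℕ → List (V × V)
rightArcEdges lefts (c , d) =
  (bd d , target (selectMin gt crs)) ∷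
  map (λ L → (src (proj₂ L) c , target (selectMin gt (filterB (λ L′ → gt L L′) crs)))) crs
  where
  crs = filterB (λ L → crosses L (c , d)) lefts
  gt : ℕ × ℕ → ℕ × ℕ → Bool
  gt L L′ = ltX (crossX L′ (c , d)) (crossX L (c , d))
  target : Maybe (ℕ × ℕ) → V
  target nothing  = yv c
  target (just L) = snk (proj₂ L) c

wT : (n : ℕ) → Tab3' n → Maybe Web
wT n G =
  matchArcs top mids >>= λ lefts →
  matchArcs mid bots >>= λ rights →
  just (mkWeb (3 * n)
    (map (λ j → (bd j , yv j)) mids
     ++ concatMap (leftArcEdges rights) lefts
     ++ concatMap (rightArcEdges lefts) rights
     ++ concatMap (λ L → map (λ R → (src (proj₂ L) (proj₁ R) , snk (proj₂ L) (proj₁ R)))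
                             (filterB (crosses L) rights)) lefts))
  where
  top mid bot : List ℕ
  top = map (G (Fin.fromℕ< {0} (ℕ.s≤s ℕ.z≤n))) (allFin n)
  mid = map (G (Fin.fromℕ< {1} (ℕ.s≤s (ℕ.s≤s ℕ.z≤n)))) (allFin n)
  bot = map (G (Fin.fromℕ< {2} (ℕ.s≤s (ℕ.s≤s (ℕ.s≤s ℕ.z≤n))))) (allFin n)
  -- middle / bottom row entries in increasing order
  mids bots : List ℕ
  mids = filterB (λ j → memb j mid) (range1 (3 * n))
  bots = filterB (λ j → memb j bot) (range1 (3 * n))

nbrOf : Web → ℕ → Maybe V
nbrOf w j = foldr step nothing (edges w)
  where
  step : V × V → Maybe V → Maybe V
  step (x , y) acc =
    if x ==V bd j then just y
    else if y ==V bd j then just x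
    else acc

commonNbr : Web → ℕ → Maybe V
commonNbr w i = nbrOf w (2 * i ∸ 1) >>= λ u → nbrOf w (2 * i) >>= λ u′ →
  if (u ==V u′) ∧ not (isBd u) then just u else nothing

commonNbrs : Web → List ℕ → Maybe (List (V × ℕ))
commonNbrs w []       = just []
commonNbrs w (i ∷ is) = commonNbr w i >>= λ v → commonNbrs w is >>= λ rest → just ((v , i) ∷ rest)

contract : ℕ → List (V × ℕ) → Web → Web
contract k vs w =
  mkWeb (nbd w ∸ k)
        (map (λ e → (relabel (proj₁ e) , relabel (proj₂ e)))
             (filterB (λ e → not (deleted (proj₁ e) ∨ deleted (proj₂ e))) (edges w)))
  where
  deleted : V → Bool
  deleted (bd j) = j ≤ᵇ 2 * k
  deleted _      = false
  relabel : V → V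
  relabel (bd j) = bd (j ∸ k)
  relabel v = foldr (λ p acc → if proj₁ p ==V v then bd (proj₂ p) else acc) v vs

wTs : (n k : ℕ) → Tab3 n → Maybe Web
wTs n k F =
  wT n (conj (tildeT k F)) >>= λ w →
  commonNbrs w (range1 k) >>= λ vs →
  just (contract k vs w)

-- For i ≤ k the entries 2i-1 and 2i of the standard tableau lie in different
-- rows, and the greedy arc matching of Tymoczko's construction joins their
-- boundary points either by a short left arc (top, middle), by a short right
-- arc (middle, bottom), or (top, bottom) they are the outer ends of a left and
-- a right arc that cross each other first.  In all three cases both boundary
-- edges end in a single internal vertex v_i (a Y-vertex or the sink of that
-- crossing), which keeps an incoming edge from a surviving vertex and so
-- becomes a boundary vertex with sign -.  Every other boundary vertex keeps
-- its edge directed away from it: sign +.  "Cross first" is decided by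
-- comparing exactly, as fractions, the abscissae of the intersection points of
-- semicircles: moving an endpoint outwards moves the crossing monotonically.

module Submission where

open import Defs
open import Data.Nat as ℕ using (ℕ; zero; suc; _≤_; _<_; _≤ᵇ_; _<ᵇ_; _≡ᵇ_; z≤n; s≤s; s≤s⁻¹; s<s⁻¹; _≟_; _≤?_)
open import Data.Nat.Properties
open import Data.Fin as Fin using (Fin; toℕ)
open import Data.Fin.Properties using (toℕ-injective)
open import Data.List as List using (List; []; _∷_; map; length; allFin; concatMap; foldr; replicate; _++_; applyUpTo)
open import Data.List.Properties using (map-++; map-replicate; length-++; ++-assoc; length-map; length-tabulate)
open import Data.List.Membership.Propositional using (_∈_; _∉_; find; lose)
open import Data.List.Membership.Propositional.Properties
  using (∈-++⁻; ∈-++⁺ˡ; ∈-++⁺ʳ; ∈-map⁻; ∈-map⁺; ∈-concatMap⁻; ∈-concatMap⁺; ∈-allFin)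
open import Data.List.Membership.DecPropositional _≟_ using (_∈?_)
open import Data.List.Relation.Unary.Any using (here; there)
open import Data.List.Relation.Unary.All as All using (All; []; _∷_)
open import Data.List.Relation.Unary.All.Properties using (All¬⇒¬Any)
open import Data.List.Relation.Unary.AllPairs as AllPairs using (AllPairs; []; _∷_)
import Data.List.Relation.Unary.AllPairs.Properties as AllPairs
open import Data.List.Relation.Unary.Unique.Propositional using (Unique)
open import Data.List.Relation.Unary.Unique.Propositional.Properties using (cartesianProduct⁺; allFin⁺)
open import Data.List.Relation.Binary.Pointwise using (Pointwise; []; _∷_)
open import Data.Bool using (Bool; true; false; T; not; if_then_else_; _∧_; _∨_)
open import Data.Bool.ListAction using (any)
open import Data.Maybe using (Maybe; just; nothing; _>>=_)
open import Data.Product using (_×_; _,_; proj₁; proj₂; ∃; ∃₂)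
open import Data.Product.Properties using (≡-dec)
open import Data.Sum using (_⊎_; inj₁; inj₂; [_,_]′)
open import Data.Unit using (⊤; tt)
open import Data.Empty using (⊥; ⊥-elim)
open import Function using (_∘′_; id; _$_; case_of_)
open import Relation.Nullary using (¬_; yes; no)
open import Relation.Nullary.Decidable using (T?)
open import Relation.Binary.PropositionalEquality
open import Relation.Binary.Definitions using (tri<; tri≈; tri>)

T⇒≡true : ∀ {b} → T b → b ≡ true
T⇒≡true {true} _ = refl

≡true⇒T : ∀ {b} → b ≡ true → T b
≡true⇒T refl = _

¬T⇒≡false : ∀ {b} → ¬ T b → b ≡ false
¬T⇒≡false {false} _  = refl
¬T⇒≡false {true}  ¬t with () ← ¬t _

≡false⇒¬T : ∀ {b} → b ≡ false → ¬ T b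
≡false⇒¬T refl ()

T-not⁺ : ∀ {b} → ¬ T b → T (not b)
T-not⁺ {false} _  = _
T-not⁺ {true}  ¬t = ¬t _

T-not⁻ : ∀ {b} → T (not b) → ¬ T b
T-not⁻ {false} _ ()

T-∧⁻ : ∀ {a b} → T (a ∧ b) → T a × T b
T-∧⁻ {true} {true} _ = _ , _

T-∧⁺ : ∀ {a b} → T a → T b → T (a ∧ b)
T-∧⁺ {true} {true} _ _ = _

T-∨⁻ : ∀ {a b} → T (a ∨ b) → T a ⊎ T b
T-∨⁻ {true}          _ = inj₁ _
T-∨⁻ {false} {true}  _ = inj₂ _

T-∨⁺ˡ : ∀ {a b} → T a → T (a ∨ b)
T-∨⁺ˡ {true} _ = _

T-∨⁺ʳ : ∀ {a b} → T b → T (a ∨ b)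
T-∨⁺ʳ {true}  _ = _
T-∨⁺ʳ {false} t = t

≡ᵇ-refl : ∀ m → T (m ≡ᵇ m)
≡ᵇ-refl m = ≡⇒≡ᵇ m m refl

module CrossingOrder where

  open import Data.Integer as ℤ using (ℤ; +_; 0ℤ; _+_; _-_; _*_; -_)
  import Data.Integer.Properties as ℤ
  open import Data.Integer.Tactic.RingSolver using (solve-∀)

  crosses⁻ : ∀ {a b c d} → T (crosses (a , b) (c , d)) →
             (a < c × c < b × b < d) ⊎ (c < a × a < d × d < b)
  crosses⁻ {a} {b} {c} {d} t with T-∨⁻ {(a <ᵇ c) ∧ (c <ᵇ b) ∧ (b <ᵇ d)} t
  ... | inj₁ t₁ = let x , y = T-∧⁻ {a <ᵇ c} t₁ ; y₁ , y₂ = T-∧⁻ {c <ᵇ b} y in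
    inj₁ (<ᵇ⇒< a c x , <ᵇ⇒< c b y₁ , <ᵇ⇒< b d y₂)
  ... | inj₂ t₂ = let x , y = T-∧⁻ {c <ᵇ a} t₂ ; y₁ , y₂ = T-∧⁻ {a <ᵇ d} y in
    inj₂ (<ᵇ⇒< c a x , <ᵇ⇒< a d y₁ , <ᵇ⇒< d b y₂)

  crosses⁺ : ∀ {a b c d} → c < a → a < d → d < b → T (crosses (a , b) (c , d))
  crosses⁺ {a} {b} {c} {d} c<a a<d d<b =
    T-∨⁺ʳ {(a <ᵇ c) ∧ (c <ᵇ b) ∧ (b <ᵇ d)} (T-∧⁺ (<⇒<ᵇ c<a) (T-∧⁺ (<⇒<ᵇ a<d) (<⇒<ᵇ d<b)))

  ¬crosses-shortˡ : ∀ {a c d} → ¬ T (crosses (a , suc a) (c , d))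
  ¬crosses-shortˡ {a} {c} {d} t with crosses⁻ {a} {suc a} {c} {d} t
  ... | inj₁ (a<c , c<1+a , _) = <⇒≱ c<1+a a<c
  ... | inj₂ (_ , a<d , d<1+a) = <⇒≱ d<1+a a<d

  ¬crosses-shortʳ : ∀ {a b c} → ¬ T (crosses (a , b) (c , suc c))
  ¬crosses-shortʳ {a} {b} {c} t with crosses⁻ {a} {b} {c} {suc c} t
  ... | inj₁ (_ , c<b , b<1+c) = <⇒≱ b<1+c c<b
  ... | inj₂ (c<a , a<1+c , _) = <⇒≱ a<1+c c<a

  -- For p < r < q < s the semicircles over [p,q] and [r,s] meet above the
  -- root n/d of the linear function (x-p)(x-q) - (x-r)(x-s).
  crossing : ℤ → ℤ → ℤ → ℤ → ℤ × ℤ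
  crossing p r q s = (r * s - p * q , (r + s) - (p + q))

  _≺_ : ℤ × ℤ → ℤ × ℤ → Set
  (n₁ , d₁) ≺ (n₂ , d₂) = n₁ * d₂ ℤ.< n₂ * d₁

  record PositiveDen (x : ℤ × ℤ) : Set where
    constructor positiveDen
    field 0<den : 0ℤ ℤ.< proj₂ x

  ≺⇒ltX : ∀ {x y} → x ≺ y → T (ltX x y)
  ≺⇒ltX {n₁ , d₁} {n₂ , d₂} lt = T-not⁺ (λ t → ℤ.<⇒≱ lt (ℤ.≤ᵇ⇒≤ t))

  ltX⇒≺ : ∀ {x y} → T (ltX x y) → x ≺ y
  ltX⇒≺ {n₁ , d₁} {n₂ , d₂} t = ℤ.≰⇒> (λ le → T-not⁻ t (ℤ.≤⇒≤ᵇ le))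

  0<-diff : ∀ {i j} → i ℤ.< j → 0ℤ ℤ.< j - i
  0<-diff {i} {j} i<j = subst (ℤ._< j - i) (ℤ.+-inverseʳ i) (ℤ.+-monoˡ-< (- i) i<j)

  0<-+ : ∀ {i j} → 0ℤ ℤ.< i → 0ℤ ℤ.< j → 0ℤ ℤ.< i + j
  0<-+ = ℤ.+-mono-<

  0<-* : ∀ {i j} → 0ℤ ℤ.< i → 0ℤ ℤ.< j → 0ℤ ℤ.< i * j
  0<-* {i} {j} 0<i 0<j = subst (ℤ._< i * j) (ℤ.*-zeroʳ i) (ℤ.*-monoˡ-<-pos i {{ℤ.positive 0<i}} 0<j)

  <-by-excess : ∀ {i j} e → j ≡ i + e → 0ℤ ℤ.< e → i ℤ.< j
  <-by-excess {i} e refl 0<e = subst (ℤ._< i + e) (ℤ.+-identityʳ i) (ℤ.+-monoʳ-< i 0<e)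

  ≺-trans : ∀ {x y z} → PositiveDen x → PositiveDen y → PositiveDen z → x ≺ y → y ≺ z → x ≺ z
  ≺-trans {n₁ , d₁} {n₂ , d₂} {n₃ , d₃} (positiveDen 0<d₁) (positiveDen 0<d₂) (positiveDen 0<d₃) x≺y y≺z =
    ℤ.*-cancelʳ-<-nonNeg d₂ {{ℤ.nonNegative (ℤ.<⇒≤ 0<d₂)}} (begin-strict
      n₁ * d₃ * d₂ ≡⟨ swap n₁ d₃ d₂ ⟩
      n₁ * d₂ * d₃ <⟨ ℤ.*-monoʳ-<-pos d₃ {{ℤ.positive 0<d₃}} x≺y ⟩
      n₂ * d₁ * d₃ ≡⟨ swap n₂ d₁ d₃ ⟩
      n₂ * d₃ * d₁ <⟨ ℤ.*-monoʳ-<-pos d₁ {{ℤ.positive 0<d₁}} y≺z ⟩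
      n₃ * d₂ * d₁ ≡⟨ swap n₃ d₂ d₁ ⟩
      n₃ * d₁ * d₂ ∎)
    where
    open ℤ.≤-Reasoning
    swap : ∀ a b c → a * b * c ≡ a * c * b
    swap = solve-∀

  crossing-positiveDen : ∀ {p r q s} → p ℤ.< r → r ℤ.< q → q ℤ.< s → PositiveDen (crossing p r q s)
  crossing-positiveDen {p} {r} {q} {s} p<r _ q<s = positiveDen $
    subst (0ℤ ℤ.<_) (den≡ p r q s) (0<-+ (0<-diff p<r) (0<-diff q<s))
    where
    den≡ : ∀ p r q s → (r - p) + (s - q) ≡ (r + s) - (p + q)
    den≡ = solve-∀

  module _ {p r q s : ℤ} (p<r : p ℤ.< r) (r<q : r ℤ.< q) (q<s : q ℤ.< s) where

    private
      0<d : 0ℤ ℤ.< proj₂ (crossing p r q s)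
      0<d = PositiveDen.0<den (crossing-positiveDen p<r r<q q<s)

    crossing-≺-separated : ∀ {p′ r′ q′ s′} → p′ ℤ.< r′ → r′ ℤ.< q′ → q′ ℤ.< s′ → q ℤ.< r′ →
                           crossing p r q s ≺ crossing p′ r′ q′ s′
    crossing-≺-separated {p′} {r′} {q′} {s′} p′<r′ r′<q′ q′<s′ q<r′ =
      <-by-excess _ (excess p r q s p′ r′ q′ s′)
        (0<-+ (0<-+ (0<-* (0<-* (0<-diff p′<r′) (0<-diff r′<q′)) 0<d)
                    (0<-* (0<-* (0<-diff q<r′) 0<d) (PositiveDen.0<den (crossing-positiveDen p′<r′ r′<q′ q′<s′))))
              (0<-* (0<-* (0<-diff r<q) (0<-diff q<s)) (PositiveDen.0<den (crossing-positiveDen p′<r′ r′<q′ q′<s′))))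
      where
      excess : ∀ p r q s p′ r′ q′ s′ →
        (r′ * s′ - p′ * q′) * ((r + s) - (p + q)) ≡
        (r * s - p * q) * ((r′ + s′) - (p′ + q′)) +
        ((r′ - p′) * (q′ - r′) * ((r + s) - (p + q))
         + (r′ - q) * ((r + s) - (p + q)) * ((r′ + s′) - (p′ + q′))
         + (q - r) * (s - q) * ((r′ + s′) - (p′ + q′)))
      excess = solve-∀

    crossing-≺-widen-outer : ∀ {p′ q′} → p′ ℤ.< p → q ℤ.< q′ → crossing p r q s ≺ crossing p′ r q′ s
    crossing-≺-widen-outer {p′} {q′} p′<p q<q′ =
      <-by-excess _ (excess p r q s p′ q′)
        (0<-+ (0<-+ (0<-* (0<-* (0<-diff p′<p) (0<-diff r<q)) (0<-diff q<s))
                    (0<-* (0<-* (0<-diff q<q′) (0<-diff p<r)) (0<-diff (ℤ.<-trans p<r (ℤ.<-trans r<q q<s)))))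
              (0<-* (0<-* (0<-diff p′<p) (0<-diff q<q′)) 0<d))
      where
      excess : ∀ p r q s p′ q′ →
        (r * s - p′ * q′) * ((r + s) - (p + q)) ≡
        (r * s - p * q) * ((r + s) - (p′ + q′)) +
        ((p - p′) * (q - r) * (s - q) + (q′ - q) * (r - p) * (s - p)
         + (p - p′) * (q′ - q) * ((r + s) - (p + q)))
      excess = solve-∀

    crossing-≺-narrow-inner : ∀ {r′ s′} → r ℤ.< r′ → r′ ℤ.< q → q ℤ.< s′ → s′ ℤ.< s →
                              crossing p r q s ≺ crossing p r′ q s′
    crossing-≺-narrow-inner {r′} {s′} r<r′ r′<q q<s′ s′<s =
      <-by-excess _ (excess p r q s r′ s′)
        (0<-+ (0<-+ (0<-* (0<-* (0<-diff r<r′) (0<-diff s′<s)) (0<-diff r<q))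
                    (0<-* (0<-* (0<-diff r<r′) (0<-diff q<s′)) (0<-diff (ℤ.<-trans p<r (ℤ.<-trans r<q q<s)))))
              (0<-* (0<-* (0<-diff s′<s) (0<-diff p<r)) (0<-diff r<q)))
      where
      excess : ∀ p r q s r′ s′ →
        (r′ * s′ - p * q) * ((r + s) - (p + q)) ≡
        (r * s - p * q) * ((r′ + s′) - (p + q)) +
        ((r′ - r) * (s - s′) * (q - r) + (r′ - r) * (s′ - q) * (s - p) + (s - s′) * (r - p) * (q - r))
      excess = solve-∀

  module _ {p r q s : ℕ} (p<r : p < r) (r<q : r < q) (q<s : q < s) where

    private
      p+q<r+s : ℤ.+ (p ℕ.+ q) ℤ.< + (r ℕ.+ s)
      p+q<r+s = ℤ.+<+ (+-mono-< p<r q<s)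

      as-crossing : ∀ {x y} → x ≡ + (r ℕ.* s) - + (p ℕ.* q) → y ≡ + (r ℕ.+ s) - + (p ℕ.+ q) →
                    (x , y) ≡ crossing (+ p) (+ r) (+ q) (+ s)
      as-crossing refl refl =
        cong₂ _,_ (cong₂ _-_ (ℤ.pos-* r s) (ℤ.pos-* p q)) (cong₂ _-_ (ℤ.pos-+ r s) (ℤ.pos-+ p q))

      neg-swap : ∀ i j → - (i - j) ≡ j - i
      neg-swap = solve-∀

      den≤0 : + (p ℕ.+ q) - + (r ℕ.+ s) ℤ.≤ 0ℤ
      den≤0 = ℤ.<⇒≤ (subst (ℤ._< 0ℤ) (neg-swap (+ (r ℕ.+ s)) (+ (p ℕ.+ q))) (ℤ.neg-mono-< (0<-diff p+q<r+s)))

    crossX-outer : crossX (p , q) (r , s) ≡ crossing (+ p) (+ r) (+ q) (+ s)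
    crossX-outer rewrite ¬T⇒≡false (λ t → ℤ.<⇒≱ (0<-diff p+q<r+s) (ℤ.≤ᵇ⇒≤ t)) = as-crossing refl refl

    crossX-inner : crossX (r , s) (p , q) ≡ crossing (+ p) (+ r) (+ q) (+ s)
    crossX-inner rewrite T⇒≡true (ℤ.≤⇒≤ᵇ den≤0) = as-crossing (neg-swap (+ (p ℕ.* q)) (+ (r ℕ.* s))) (neg-swap (+ (p ℕ.+ q)) (+ (r ℕ.+ s)))

  crossX-positiveDen : ∀ {a b c d} → T (crosses (a , b) (c , d)) → PositiveDen (crossX (a , b) (c , d))
  crossX-positiveDen {a} {b} {c} {d} t with crosses⁻ {a} {b} {c} {d} t
  ... | inj₁ (a<c , c<b , b<d) rewrite crossX-outer a<c c<b b<d =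
    crossing-positiveDen (ℤ.+<+ a<c) (ℤ.+<+ c<b) (ℤ.+<+ b<d)
  ... | inj₂ (c<a , a<d , d<b) rewrite crossX-inner c<a a<d d<b =
    crossing-positiveDen (ℤ.+<+ c<a) (ℤ.+<+ a<d) (ℤ.+<+ d<b)

  ltX-trans : ∀ {x y z} → PositiveDen x → PositiveDen y → PositiveDen z →
              T (ltX x y) → T (ltX y z) → T (ltX x z)
  ltX-trans {x} {y} {z} 0<x 0<y 0<z t u =
    ≺⇒ltX {x} {z} (≺-trans {x} {y} {z} 0<x 0<y 0<z (ltX⇒≺ {x} {y} t) (ltX⇒≺ {y} {z} u))

  ltX-irrefl : ∀ {x} → ¬ T (ltX x x)
  ltX-irrefl {x} t = ℤ.<-irrefl refl (ltX⇒≺ {x} {x} t)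

  ltX-crossings : ∀ {x y x′ y′} → x ≡ x′ → y ≡ y′ → x′ ≺ y′ → T (ltX x y)
  ltX-crossings {x} {y} refl refl = ≺⇒ltX {x} {y}

  ltX-asym : ∀ {x y} → T (ltX x y) → ¬ T (ltX y x)
  ltX-asym {x} {y} t u = ℤ.<-asym (ltX⇒≺ {x} {y} t) (ltX⇒≺ {y} {x} u)

  ltX-along-left-arc-separated : ∀ {a b c c′ d′} → c < a → suc a < c′ → c′ < b → b < d′ →
    T (ltX (crossX (a , b) (c , suc a)) (crossX (a , b) (c′ , d′)))
  ltX-along-left-arc-separated {a} c<a 1+a<c′ c′<b b<d′ =
    ltX-crossings (crossX-inner c<a a<1+a a<b) (crossX-outer a<c′ c′<b b<d′)
      (crossing-≺-separated (ℤ.+<+ c<a) (ℤ.+<+ a<1+a) (ℤ.+<+ a<b) (ℤ.+<+ a<c′) (ℤ.+<+ c′<b) (ℤ.+<+ b<d′) (ℤ.+<+ 1+a<c′))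
    where
    a<1+a = n<1+n a
    a<b   = <-trans 1+a<c′ c′<b
    a<c′  = <-trans a<1+a 1+a<c′

  ltX-along-left-arc-nested : ∀ {a b c c′ d′} → c′ < c → c < a → suc a < d′ → d′ < b →
    T (ltX (crossX (a , b) (c , suc a)) (crossX (a , b) (c′ , d′)))
  ltX-along-left-arc-nested {a} c′<c c<a 1+a<d′ d′<b =
    ltX-crossings (crossX-inner c<a a<1+a 1+a<b) (crossX-inner (<-trans c′<c c<a) (<-trans a<1+a 1+a<d′) d′<b)
      (crossing-≺-widen-outer (ℤ.+<+ c<a) (ℤ.+<+ a<1+a) (ℤ.+<+ 1+a<b) (ℤ.+<+ c′<c) (ℤ.+<+ 1+a<d′))
    where
    a<1+a = n<1+n a
    1+a<b = <-trans 1+a<d′ d′<b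

  ltX-along-right-arc-separated : ∀ {a b c a′ b′} → a′ < c → c < b′ → b′ < a → suc a < b →
    T (ltX (crossX (a′ , b′) (c , suc a)) (crossX (a , b) (c , suc a)))
  ltX-along-right-arc-separated {a} a′<c c<b′ b′<a 1+a<b =
    ltX-crossings (crossX-outer a′<c c<b′ b′<1+a) (crossX-inner c<a a<1+a 1+a<b)
      (crossing-≺-separated (ℤ.+<+ a′<c) (ℤ.+<+ c<b′) (ℤ.+<+ b′<1+a) (ℤ.+<+ c<a) (ℤ.+<+ a<1+a) (ℤ.+<+ 1+a<b) (ℤ.+<+ b′<a))
    where
    a<1+a  = n<1+n a
    b′<1+a = <-trans b′<a a<1+a
    c<a    = <-trans c<b′ b′<a

  ltX-along-right-arc-nested : ∀ {a b c a′ b′} → c < a′ → a′ < a → suc a < b → b < b′ →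
    T (ltX (crossX (a′ , b′) (c , suc a)) (crossX (a , b) (c , suc a)))
  ltX-along-right-arc-nested {a} c<a′ a′<a 1+a<b b<b′ =
    ltX-crossings (crossX-inner c<a′ a′<1+a 1+a<b′) (crossX-inner (<-trans c<a′ a′<a) a<1+a 1+a<b)
      (crossing-≺-narrow-inner (ℤ.+<+ c<a′) (ℤ.+<+ a′<1+a) (ℤ.+<+ 1+a<b′) (ℤ.+<+ a′<a) (ℤ.+<+ a<1+a) (ℤ.+<+ 1+a<b) (ℤ.+<+ b<b′))
    where
    a<1+a  = n<1+n a
    a′<1+a = <-trans a′<a a<1+a
    1+a<b′ = <-trans 1+a<b b<b′

open CrossingOrder
  using ( PositiveDen; crosses⁻; crosses⁺; ¬crosses-shortˡ; ¬crosses-shortʳ; crossX-positiveDen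
        ; ltX-trans; ltX-irrefl; ltX-asym
        ; ltX-along-left-arc-separated; ltX-along-left-arc-nested
        ; ltX-along-right-arc-separated; ltX-along-right-arc-nested )

-- opened only here: CrossingOrder uses the integer operators of the same names
open import Data.Nat using (_+_; _*_; _∸_)

module _ {A : Set} (p : A → Bool) where

  ∈-filterB⁻ : ∀ {x} xs → x ∈ filterB p xs → x ∈ xs × T (p x)
  ∈-filterB⁻ (y ∷ xs) x∈ with p y in eq
  ∈-filterB⁻ (y ∷ xs) (here refl) | true = here refl , ≡true⇒T eq
  ∈-filterB⁻ (y ∷ xs) (there x∈) | true = let x∈xs , px = ∈-filterB⁻ xs x∈ in there x∈xs , px
  ... | false = let x∈xs , px = ∈-filterB⁻ xs x∈ in there x∈xs , px

  ∈-filterB⁺ : ∀ {x} xs → x ∈ xs → T (p x) → x ∈ filterB p xs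
  ∈-filterB⁺ (y ∷ xs) (here refl) px with p y
  ... | true = here refl
  ∈-filterB⁺ (y ∷ xs) (there x∈) px with p y
  ... | true  = there (∈-filterB⁺ xs x∈ px)
  ... | false = ∈-filterB⁺ xs x∈ px

  filterB-nonempty : ∀ xs → 0 < length (filterB p xs) → ∃ λ x → x ∈ xs × T (p x)
  filterB-nonempty (y ∷ xs) h with p y in eq
  ... | true  = y , here refl , ≡true⇒T eq
  ... | false = let x , x∈ , px = filterB-nonempty xs h in x , there x∈ , px

  filterB-none : ∀ xs → (∀ {x} → x ∈ xs → ¬ T (p x)) → filterB p xs ≡ []
  filterB-none []       _ = refl
  filterB-none (y ∷ xs) h with p y in eq
  ... | true  = ⊥-elim (h (here refl) (≡true⇒T eq))
  ... | false = filterB-none xs (h ∘′ there)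

  filterB-++ : ∀ xs ys → filterB p (xs ++ ys) ≡ filterB p xs ++ filterB p ys
  filterB-++ []       ys = refl
  filterB-++ (x ∷ xs) ys with p x
  ... | true  = cong (x ∷_) (filterB-++ xs ys)
  ... | false = filterB-++ xs ys

filterB-cong : ∀ {A : Set} (p q : A → Bool) xs → (∀ {x} → x ∈ xs → p x ≡ q x) → filterB p xs ≡ filterB q xs
filterB-cong p q []       h = refl
filterB-cong p q (y ∷ xs) h with p y | q y | h (here refl)
... | true  | .true  | refl = cong (y ∷_) (filterB-cong p q xs (λ m → h (there m)))
... | false | .false | refl = filterB-cong p q xs (λ m → h (there m))

Increasing : List ℕ → Set
Increasing = AllPairs _<_

head∉ : ∀ {x : ℕ} {xs} → Unique (x ∷ xs) → x ∉ xs
head∉ (x≢xs ∷ _) = All¬⇒¬Any x≢xs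

>>=-just : ∀ {A B : Set} {m : Maybe A} {x} (f : A → Maybe B) → m ≡ just x → (m >>= f) ≡ f x
>>=-just f refl = refl

countBelow : ℕ → List ℕ → ℕ
countBelow j xs = length (filterB (λ x → x <ᵇ j) xs)

∈-removeN⁻ : ∀ {i x} xs → x ∈ removeN i xs → x ∈ xs × x ≢ i
∈-removeN⁻ {i} {x} xs x∈ =
  let x∈xs , t = ∈-filterB⁻ (λ y → not (y ≡ᵇ i)) xs x∈ in x∈xs , λ x≡i → T-not⁻ t (≡⇒≡ᵇ x i x≡i)

∈-removeN⁺ : ∀ {i x} xs → x ∈ xs → x ≢ i → x ∈ removeN i xs
∈-removeN⁺ {i} {x} xs x∈ x≢i = ∈-filterB⁺ (λ y → not (y ≡ᵇ i)) xs x∈ (T-not⁺ (λ t → x≢i (≡ᵇ⇒≡ x i t)))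

removeN-unique : ∀ i xs → Unique xs → Unique (removeN i xs)
removeN-unique i []       [] = []
removeN-unique i (y ∷ xs) (y≢xs ∷ u) with not (y ≡ᵇ i)
... | true  = All.tabulate (λ x∈ → All.lookup y≢xs (proj₁ (∈-removeN⁻ xs x∈))) ∷ removeN-unique i xs u
... | false = removeN-unique i xs u

removeN-∉ : ∀ i xs → i ∉ xs → removeN i xs ≡ xs
removeN-∉ i []       _   = refl
removeN-∉ i (y ∷ xs) i∉ with y ≡ᵇ i in eq
... | true  = ⊥-elim (i∉ (here (sym (≡ᵇ⇒≡ y i (≡true⇒T eq)))))
... | false = cong (y ∷_) (removeN-∉ i xs (i∉ ∘′ there))

length-removeN : ∀ i xs → i ∈ xs → Unique xs → suc (length (removeN i xs)) ≡ length xs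
length-removeN i (y ∷ xs) (here refl) u rewrite T⇒≡true (≡ᵇ-refl i) =
  cong (suc ∘′ length) (removeN-∉ i xs (head∉ u))
length-removeN i (y ∷ xs) (there i∈) u with y ≡ᵇ i in eq
... | true  = ⊥-elim (head∉ u (subst (_∈ xs) (sym (≡ᵇ⇒≡ y i (≡true⇒T eq))) i∈))
... | false = cong suc (length-removeN i xs i∈ (AllPairs.tail u))

countBelow-removeN : ∀ i j xs → i ∈ xs → Unique xs → i < j → suc (countBelow j (removeN i xs)) ≡ countBelow j xs
countBelow-removeN i j (y ∷ xs) (here refl) u i<j
  rewrite T⇒≡true (≡ᵇ-refl i) | T⇒≡true (<⇒<ᵇ i<j) = cong (suc ∘′ countBelow j) (removeN-∉ i xs (head∉ u))
countBelow-removeN i j (y ∷ xs) (there i∈) u i<j with y ≡ᵇ i in eq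
... | true = ⊥-elim (head∉ u (subst (_∈ xs) (sym (≡ᵇ⇒≡ y i (≡true⇒T eq))) i∈))
... | false with y <ᵇ j
...   | true  = cong suc (countBelow-removeN i j xs i∈ (AllPairs.tail u) i<j)
...   | false = countBelow-removeN i j xs i∈ (AllPairs.tail u) i<j

largestBelow-nothing : ∀ j xs → largestBelow j xs ≡ nothing → ∀ {x} → x ∈ xs → ¬ x < j
largestBelow-nothing j (y ∷ xs) eq x∈ x<j with y <ᵇ j in e₁ | largestBelow j xs in e₂
largestBelow-nothing j (y ∷ xs) () x∈ x<j | true | nothing
largestBelow-nothing j (y ∷ xs) () x∈ x<j | true | just _
largestBelow-nothing j (y ∷ xs) eq (here refl) x<j | false | _ = ≡false⇒¬T e₁ (<⇒<ᵇ x<j)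
largestBelow-nothing j (y ∷ xs) eq (there x∈) x<j | false | _ = largestBelow-nothing j xs (trans e₂ eq) x∈ x<j

IsLargestBelow : ℕ → List ℕ → ℕ → Set
IsLargestBelow j xs i = i ∈ xs × i < j × (∀ {x} → x ∈ xs → x < j → x ≤ i)

largestBelow-just : ∀ j xs {i} → largestBelow j xs ≡ just i → IsLargestBelow j xs i
largestBelow-just j (y ∷ xs) {i} eq with y <ᵇ j in e₁ | largestBelow j xs in e₂
largestBelow-just j (y ∷ xs) refl | true | nothing =
  here refl , <ᵇ⇒< y j (≡true⇒T e₁) ,
  λ { (here refl) _ → ≤-refl ; (there x∈) x<j → ⊥-elim (largestBelow-nothing j xs e₂ x∈ x<j) }
largestBelow-just j (y ∷ xs) eq | true | just m with largestBelow-just j xs e₂ | m <ᵇ y in e₃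
largestBelow-just j (y ∷ xs) refl | true | just m | (_ , _ , m-max) | true =
  here refl , <ᵇ⇒< y j (≡true⇒T e₁) ,
  λ { (here refl) _ → ≤-refl ; (there x∈) x<j → ≤-trans (m-max x∈ x<j) (<⇒≤ (<ᵇ⇒< m y (≡true⇒T e₃))) }
largestBelow-just j (y ∷ xs) refl | true | just m | (m∈ , m<j , m-max) | false =
  there m∈ , m<j ,
  λ { (here refl) _ → ≮⇒≥ (λ m<y → ≡false⇒¬T e₃ (<⇒<ᵇ m<y)) ; (there x∈) x<j → m-max x∈ x<j }
largestBelow-just j (y ∷ xs) eq | false | _ =
  let i∈ , i<j , i-max = largestBelow-just j xs (trans e₂ eq) in
  there i∈ , i<j , λ { (here refl) y<j → ⊥-elim (≡false⇒¬T e₁ (<⇒<ᵇ y<j)) ; (there x∈) x<j → i-max x∈ x<j }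

largestBelow-defined : ∀ j xs → 0 < countBelow j xs → ∃ λ i → largestBelow j xs ≡ just i
largestBelow-defined j xs h with largestBelow j xs in eq
... | just i  = i , refl
... | nothing =
  let x , x∈ , x<j = filterB-nonempty (λ x → x <ᵇ j) xs h in
  ⊥-elim (largestBelow-nothing j xs eq x∈ (<ᵇ⇒< x j x<j))

Ballot : ℕ → List ℕ → List ℕ → Set
Ballot m cs []       = ⊤
Ballot m cs (j ∷ js) = m < countBelow j cs × Ballot (suc m) cs js

Ballot-removeN : ∀ m cs js i → Ballot (suc m) cs js → i ∈ cs → Unique cs → All (i <_) js →
                 Ballot m (removeN i cs) js
Ballot-removeN m cs []       i _         _  _ _            = _
Ballot-removeN m cs (j ∷ js) i (h , bal) i∈ u (i<j ∷ i<js) =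
  s<s⁻¹ (subst (suc m <_) (sym (countBelow-removeN i j cs i∈ u i<j)) h) ,
  Ballot-removeN (suc m) cs js i bal i∈ u i<js

matchArcs-∷ : ∀ cs j js {arcs} → matchArcs cs (j ∷ js) ≡ just arcs →
  ∃₂ λ i rest → largestBelow j cs ≡ just i × matchArcs (removeN i cs) js ≡ just rest × arcs ≡ (i , j) ∷ rest
matchArcs-∷ cs j js eq with largestBelow j cs
... | just i with matchArcs (removeN i cs) js in e
...   | just rest with refl ← eq = i , rest , refl , e , refl

matchArcs-defined : ∀ cs js → Unique cs → Increasing js → Ballot 0 cs js → ∃ λ arcs → matchArcs cs js ≡ just arcs
matchArcs-defined cs []       _ _            _         = [] , refl
matchArcs-defined cs (j ∷ js) u (j<js ∷ inc) (h , bal) with largestBelow-defined j cs h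
... | i , e₁ with largestBelow-just j cs e₁
...   | i∈ , i<j , _ with matchArcs-defined (removeN i cs) js (removeN-unique i cs u) inc
                            (Ballot-removeN 0 cs js i bal i∈ u (All.map (<-trans i<j) j<js))
...     | rest , e₂ rewrite e₁ | e₂ = (i , j) ∷ rest , refl

matchArcs-∈ : ∀ cs js {arcs} → matchArcs cs js ≡ just arcs → ∀ {i j} → (i , j) ∈ arcs → i ∈ cs × j ∈ js × i < j
matchArcs-∈ cs [] refl ()
matchArcs-∈ cs (j ∷ js) eq a∈ with matchArcs-∷ cs j js eq
matchArcs-∈ cs (j ∷ js) eq (here refl) | i , rest , e₁ , e₂ , refl =
  let i∈ , i<j , _ = largestBelow-just j cs e₁ in i∈ , here refl , i<j
matchArcs-∈ cs (j ∷ js) eq (there a∈) | i , rest , e₁ , e₂ , refl =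
  let x∈ , y∈ , x<y = matchArcs-∈ (removeN i cs) js e₂ a∈ in proj₁ (∈-removeN⁻ cs x∈) , there y∈ , x<y

matchArcs-covers-targets : ∀ cs js {arcs} → matchArcs cs js ≡ just arcs → ∀ {j} → j ∈ js → ∃ λ i → (i , j) ∈ arcs
matchArcs-covers-targets cs (j ∷ js) eq j∈ with matchArcs-∷ cs j js eq
matchArcs-covers-targets cs (j ∷ js) eq (here refl) | i , rest , e₁ , e₂ , refl = i , here refl
matchArcs-covers-targets cs (j ∷ js) eq (there j∈) | i , rest , e₁ , e₂ , refl =
  let i′ , a∈ = matchArcs-covers-targets (removeN i cs) js e₂ j∈ in i′ , there a∈

matchArcs-covers-sources : ∀ cs js {arcs} → matchArcs cs js ≡ just arcs → Unique cs → length cs ≡ length js →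
  ∀ {i} → i ∈ cs → ∃ λ j → (i , j) ∈ arcs
matchArcs-covers-sources (c ∷ cs) [] eq u () i∈
matchArcs-covers-sources cs (j ∷ js) eq u len {x} x∈ with matchArcs-∷ cs j js eq
... | i , rest , e₁ , e₂ , refl with x ≟ i
...   | yes refl = j , here refl
...   | no x≢i =
  let len′ = suc-injective (trans (length-removeN i cs (proj₁ (largestBelow-just j cs e₁)) u) len)
      j′ , a∈ = matchArcs-covers-sources (removeN i cs) js e₂ (removeN-unique i cs u) len′ (∈-removeN⁺ cs x∈ x≢i)
  in j′ , there a∈

matchArcs-functional : ∀ cs js {arcs} → matchArcs cs js ≡ just arcs → ∀ {i j j′} → (i , j) ∈ arcs → (i , j′) ∈ arcs → j ≡ j′
matchArcs-functional cs [] refl ()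
matchArcs-functional cs (j ∷ js) eq a∈ a′∈ with matchArcs-∷ cs j js eq
matchArcs-functional cs (j ∷ js) eq (here refl) (here refl)  | _ , _ , _ , _ , refl = refl
matchArcs-functional cs (j ∷ js) eq (here refl) (there a′∈) | i , _ , _ , e₂ , refl =
  ⊥-elim (proj₂ (∈-removeN⁻ cs (proj₁ (matchArcs-∈ (removeN i cs) js e₂ a′∈))) refl)
matchArcs-functional cs (j ∷ js) eq (there a∈) (here refl)  | i , _ , _ , e₂ , refl =
  ⊥-elim (proj₂ (∈-removeN⁻ cs (proj₁ (matchArcs-∈ (removeN i cs) js e₂ a∈))) refl)
matchArcs-functional cs (j ∷ js) eq (there a∈) (there a′∈) | i , _ , _ , e₂ , refl =
  matchArcs-functional (removeN i cs) js e₂ a∈ a′∈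

matchArcs-injective : ∀ cs js {arcs} → matchArcs cs js ≡ just arcs → Increasing js →
  ∀ {i i′ j} → (i , j) ∈ arcs → (i′ , j) ∈ arcs → i ≡ i′
matchArcs-injective cs [] refl _ ()
matchArcs-injective cs (j ∷ js) eq inc a∈ a′∈ with matchArcs-∷ cs j js eq
matchArcs-injective cs (j ∷ js) eq _ (here refl) (here refl) | _ , _ , _ , _ , refl = refl
matchArcs-injective cs (j ∷ js) eq (j<js ∷ _) (here refl) (there a′∈) | i , _ , _ , e₂ , refl =
  ⊥-elim (<-irrefl refl (All.lookup j<js (proj₁ (proj₂ (matchArcs-∈ (removeN i cs) js e₂ a′∈)))))
matchArcs-injective cs (j ∷ js) eq (j<js ∷ _) (there a∈) (here refl) | i , _ , _ , e₂ , refl =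
  ⊥-elim (<-irrefl refl (All.lookup j<js (proj₁ (proj₂ (matchArcs-∈ (removeN i cs) js e₂ a∈)))))
matchArcs-injective cs (j ∷ js) eq (_ ∷ inc) (there a∈) (there a′∈) | i , _ , _ , e₂ , refl =
  matchArcs-injective (removeN i cs) js e₂ inc a∈ a′∈

matchArcs-noncrossing : ∀ cs js {arcs} → matchArcs cs js ≡ just arcs → Increasing js →
  ∀ {i j i′ j′} → (i , j) ∈ arcs → (i′ , j′) ∈ arcs → i < i′ → i′ < j → j < j′ → ⊥
matchArcs-noncrossing cs [] refl _ ()
matchArcs-noncrossing cs (j ∷ js) eq inc a∈ a′∈ i<i′ i′<j j<j′ with matchArcs-∷ cs j js eq
matchArcs-noncrossing cs (j ∷ js) eq _ (here refl) (here refl) _ _ j<j′ | _ , _ , _ , _ , refl = <-irrefl refl j<j′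
matchArcs-noncrossing cs (j ∷ js) eq _ (here refl) (there a′∈) i<i′ i′<j _ | i , _ , e₁ , e₂ , refl =
  let i′∈ , _ = matchArcs-∈ (removeN i cs) js e₂ a′∈
      _ , _ , i-max = largestBelow-just j cs e₁
  in <⇒≱ i<i′ (i-max (proj₁ (∈-removeN⁻ cs i′∈)) i′<j)
matchArcs-noncrossing cs (j ∷ js) eq (j<js ∷ _) (there a∈) (here refl) _ _ j<j′ | i , _ , _ , e₂ , refl =
  <-asym j<j′ (All.lookup j<js (proj₁ (proj₂ (matchArcs-∈ (removeN i cs) js e₂ a∈))))
matchArcs-noncrossing cs (j ∷ js) eq (_ ∷ inc) (there a∈) (there a′∈) i<i′ i′<j j<j′ | i , _ , _ , e₂ , refl =
  matchArcs-noncrossing (removeN i cs) js e₂ inc a∈ a′∈ i<i′ i′<j j<j′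

module _ {A : Set} (lt : A → A → Bool) where

  selectMin-∈ : ∀ xs {m} → selectMin lt xs ≡ just m → m ∈ xs
  selectMin-∈ (x ∷ xs) eq with selectMin lt xs in e
  selectMin-∈ (x ∷ xs) refl | nothing = here refl
  selectMin-∈ (x ∷ xs) eq   | just y with lt x y
  selectMin-∈ (x ∷ xs) refl | just y | true  = here refl
  selectMin-∈ (x ∷ xs) refl | just y | false = there (selectMin-∈ xs e)

  private
    selectMin-nonempty : ∀ xs {z} → z ∈ xs → selectMin lt xs ≢ nothing
    selectMin-nonempty (y ∷ ys) _ eq with selectMin lt ys
    selectMin-nonempty (y ∷ ys) _ () | nothing
    selectMin-nonempty (y ∷ ys) _ () | just _

    if-≡ : ∀ b {x y m : A} → (b ≡ true → x ≡ m) → (b ≡ false → y ≡ m) → (if b then x else y) ≡ m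
    if-≡ true  f _ = f refl
    if-≡ false _ g = g refl

  selectMin-least : ∀ xs {m} → m ∈ xs → (∀ {y} → y ∈ xs → y ≡ m ⊎ (T (lt m y) × ¬ T (lt y m))) →
                    selectMin lt xs ≡ just m
  selectMin-least (x ∷ xs) m∈ least with selectMin lt xs in e
  selectMin-least (x ∷ xs) (here refl) least | nothing = refl
  selectMin-least (x ∷ xs) (there m∈)  least | nothing = ⊥-elim (selectMin-nonempty xs m∈ e)
  selectMin-least (x ∷ xs) (there m∈)  least | just y
    with refl ← trans (sym e) (selectMin-least xs m∈ (least ∘′ there)) =
    cong just (if-≡ (lt x y) (λ e′ → [ id , (λ (_ , ¬y<x) → ⊥-elim (¬y<x (≡true⇒T e′))) ]′ (least (here refl)))
                             (λ _ → refl))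
  selectMin-least (x ∷ xs) (here refl) least | just y =
    cong just (if-≡ (lt x y) (λ _ → refl)
                (λ e′ → [ id , (λ (x<y , _) → ⊥-elim (≡false⇒¬T e′ x<y)) ]′ (least (there (selectMin-∈ xs e)))))

module _ {A : Set} (rel : A → A → Bool) where

  ∃-maximal : ∀ xs {x₀} → x₀ ∈ xs →
    (∀ {a b c} → a ∈ xs → b ∈ xs → c ∈ xs → T (rel a b) → T (rel b c) → T (rel a c)) →
    (∀ {a} → a ∈ xs → ¬ T (rel a a)) →
    ∃ λ m → m ∈ xs × (∀ {z} → z ∈ xs → ¬ T (rel m z))
  ∃-maximal (x ∷ []) _ _ irr = x , here refl , λ { (here refl) → irr (here refl) }
  ∃-maximal (x ∷ y ∷ ys) _ trans′ irr
    with ∃-maximal (y ∷ ys) (here refl) (λ a b c → trans′ (there a) (there b) (there c)) (irr ∘′ there)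
  ... | m , m∈ , m-max with rel m x in e
  ...   | true  = x , here refl , λ { (here refl) → irr (here refl)
                                    ; (there z∈) x<z → m-max z∈ (trans′ (there m∈) (here refl) (there z∈) (≡true⇒T e) x<z) }
  ...   | false = m , there m∈ , λ { (here refl) → ≡false⇒¬T e ; (there z∈) → m-max z∈ }

rangeFrom : ℕ → ℕ → List ℕ
rangeFrom lo zero    = []
rangeFrom lo (suc n) = lo ∷ rangeFrom (suc lo) n

range1≡rangeFrom : ∀ n → range1 n ≡ rangeFrom 1 n
range1≡rangeFrom n = trans (map-applyUpTo suc id n) (applyUpTo-shift n suc 1 (λ _ → refl))
  where
  map-applyUpTo : ∀ (g f : ℕ → ℕ) n → map g (applyUpTo f n) ≡ applyUpTo (g ∘′ f) n
  map-applyUpTo g f zero    = refl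
  map-applyUpTo g f (suc n) = cong (g (f 0) ∷_) (map-applyUpTo g (f ∘′ suc) n)
  applyUpTo-shift : ∀ n (f : ℕ → ℕ) lo → (∀ i → f i ≡ lo + i) → applyUpTo f n ≡ rangeFrom lo n
  applyUpTo-shift zero    f lo h = refl
  applyUpTo-shift (suc n) f lo h =
    cong₂ _∷_ (trans (h 0) (+-identityʳ lo)) (applyUpTo-shift n (f ∘′ suc) (suc lo) (λ i → trans (h (suc i)) (+-suc lo i)))

∈-rangeFrom⁻ : ∀ {lo n x} → x ∈ rangeFrom lo n → lo ≤ x × x < lo + n
∈-rangeFrom⁻ {lo} {suc n} (here refl) = ≤-refl , subst (lo <_) (sym (+-suc lo n)) (s≤s (m≤m+n lo n))
∈-rangeFrom⁻ {lo} {suc n} {x} (there x∈) =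
  let lo<x , x<end = ∈-rangeFrom⁻ {suc lo} {n} x∈ in <⇒≤ lo<x , subst (x <_) (sym (+-suc lo n)) x<end

∈-rangeFrom⁺ : ∀ {lo n x} → lo ≤ x → x < lo + n → x ∈ rangeFrom lo n
∈-rangeFrom⁺ {lo} {zero}  {x} lo≤x x<end = ⊥-elim (<⇒≱ x<end (subst (_≤ x) (sym (+-identityʳ lo)) lo≤x))
∈-rangeFrom⁺ {lo} {suc n} {x} lo≤x x<end with lo ≟ x
... | yes refl = here refl
... | no lo≢x  = there (∈-rangeFrom⁺ {suc lo} {n} (≤∧≢⇒< lo≤x lo≢x) (subst (x <_) (+-suc lo n) x<end))

rangeFrom-++ : ∀ lo k m → rangeFrom lo (k + m) ≡ rangeFrom lo k ++ rangeFrom (lo + k) m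
rangeFrom-++ lo zero    m = cong (λ z → rangeFrom z m) (sym (+-identityʳ lo))
rangeFrom-++ lo (suc k) m =
  cong (lo ∷_) (trans (rangeFrom-++ (suc lo) k m) (cong (λ z → rangeFrom (suc lo) k ++ rangeFrom z m) (sym (+-suc lo k))))

map-rangeFrom-const : ∀ {B : Set} lo n (f : ℕ → B) b → (∀ j → lo ≤ j → j < lo + n → f j ≡ b) →
                      map f (rangeFrom lo n) ≡ replicate n b
map-rangeFrom-const lo zero    f b h = refl
map-rangeFrom-const lo (suc n) f b h =
  cong₂ _∷_ (h lo ≤-refl (subst (lo <_) (sym (+-suc lo n)) (s≤s (m≤m+n lo n))))
    (map-rangeFrom-const (suc lo) n f b (λ j lo<j j<end → h j (<⇒≤ lo<j) (subst (j <_) (sym (+-suc lo n)) j<end)))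

map-rangeFrom-split : ∀ {B : Set} lo k m (f : ℕ → B) b c →
  (∀ j → lo ≤ j → j < lo + k → f j ≡ b) → (∀ j → lo + k ≤ j → j < lo + k + m → f j ≡ c) →
  map f (rangeFrom lo (k + m)) ≡ replicate k b ++ replicate m c
map-rangeFrom-split lo k m f b c hb hc rewrite rangeFrom-++ lo k m | map-++ f (rangeFrom lo k) (rangeFrom (lo + k) m) =
  cong₂ _++_ (map-rangeFrom-const lo k f b hb) (map-rangeFrom-const (lo + k) m f c hc)

countBelow-++ : ∀ m xs ys → countBelow m (xs ++ ys) ≡ countBelow m xs + countBelow m ys
countBelow-++ m xs ys rewrite filterB-++ (λ x → x <ᵇ m) xs ys = length-++ (filterB (λ x → x <ᵇ m) xs)

countBelow-all : ∀ m xs → All (_< m) xs → countBelow m xs ≡ length xs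
countBelow-all m []       []           = refl
countBelow-all m (x ∷ xs) (x<m ∷ xs<m) rewrite T⇒≡true (<⇒<ᵇ x<m) = cong suc (countBelow-all m xs xs<m)

-- Matching the candidates ts to the targets ms position by position is
-- possible, so the greedy matching never runs out of candidates.
Ballot-pointwise : ∀ P ts ms → Pointwise _<_ ts ms → Increasing ms → All (λ p → All (p <_) ms) P →
                   Ballot (length P) (P ++ ts) ms
Ballot-pointwise P []       []       []           _            _   = _
Ballot-pointwise P (t ∷ ts) (m ∷ ms) (t<m ∷ t<ms) (m<ms ∷ inc) P<ms =
  head , subst₂ (λ l xs → Ballot l xs ms) length-P∷ʳt (++-assoc P (t ∷ []) ts)
           (Ballot-pointwise (P ++ t ∷ []) ts ms t<ms inc (All.tabulate P∷ʳt<ms))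
  where
  P<m : All (_< m) P
  P<m = All.map (λ p<ms → All.head p<ms) P<ms
  head : length P < countBelow m (P ++ t ∷ ts)
  head rewrite countBelow-++ m P (t ∷ ts) | countBelow-all m P P<m | T⇒≡true (<⇒<ᵇ t<m) =
    subst (length P <_) (sym (+-suc (length P) _)) (s≤s (m≤m+n (length P) _))
  length-P∷ʳt : length (P ++ t ∷ []) ≡ suc (length P)
  length-P∷ʳt = trans (length-++ P) (+-comm (length P) 1)
  P∷ʳt<ms : ∀ {x} → x ∈ P ++ t ∷ [] → All (x <_) ms
  P∷ʳt<ms x∈ with ∈-++⁻ P x∈
  ... | inj₁ x∈P         = All.tail (All.lookup P<ms x∈P)
  ... | inj₂ (here refl) = All.map (<-trans t<m) m<ms

T-memb⁺ : ∀ {j} xs → j ∈ xs → T (memb j xs)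
T-memb⁺ {j} (x ∷ xs) (here refl) = T-∨⁺ˡ (≡ᵇ-refl j)
T-memb⁺ {j} (x ∷ xs) (there j∈) = T-∨⁺ʳ {j ≡ᵇ x} (T-memb⁺ xs j∈)

T-memb⁻ : ∀ {j} xs → T (memb j xs) → j ∈ xs
T-memb⁻ {j} (x ∷ xs) t with T-∨⁻ {j ≡ᵇ x} t
... | inj₁ j≡x = here (≡ᵇ⇒≡ j x j≡x)
... | inj₂ j∈  = there (T-memb⁻ xs j∈)

filterB-memb-rangeFrom : ∀ lo n xs → Increasing xs → (∀ {x} → x ∈ xs → lo ≤ x × x < lo + n) →
                         filterB (λ j → memb j xs) (rangeFrom lo n) ≡ xs
filterB-memb-rangeFrom lo zero [] _ _ = refl
filterB-memb-rangeFrom lo zero (x ∷ xs) _ bounds =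
  let lo≤x , x<end = bounds (here refl) in ⊥-elim (<⇒≱ x<end (subst (_≤ x) (sym (+-identityʳ lo)) lo≤x))
filterB-memb-rangeFrom lo (suc n) xs inc bounds with lo ∈? xs
filterB-memb-rangeFrom lo (suc n) (x ∷ xs) (x<xs ∷ _) bounds | yes (there lo∈) =
  ⊥-elim (<⇒≱ (All.lookup x<xs lo∈) (proj₁ (bounds (here refl))))
filterB-memb-rangeFrom lo (suc n) (x ∷ xs) (x<xs ∷ inc) bounds | yes (here refl) rewrite T⇒≡true (≡ᵇ-refl lo) =
  cong (lo ∷_) (trans (filterB-cong (λ j → memb j (lo ∷ xs)) (λ j → memb j xs) (rangeFrom (suc lo) n)
                         (λ {j} j∈ → cong (_∨ memb j xs) (≢lo (proj₁ (∈-rangeFrom⁻ j∈)))))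
                      (filterB-memb-rangeFrom (suc lo) n xs inc
                         (λ {y} y∈ → All.lookup x<xs y∈ , subst (y <_) (+-suc lo n) (proj₂ (bounds (there y∈))))))
  where
  ≢lo : ∀ {j} → suc lo ≤ j → (j ≡ᵇ lo) ≡ false
  ≢lo {j} lo<j = ¬T⇒≡false (λ t → <-irrefl (sym (≡ᵇ⇒≡ j lo t)) lo<j)
filterB-memb-rangeFrom lo (suc n) xs inc bounds | no lo∉ with memb lo xs in e
... | true  = ⊥-elim (lo∉ (T-memb⁻ xs (≡true⇒T e)))
... | false = filterB-memb-rangeFrom (suc lo) n xs inc
  (λ {y} y∈ → ≤∧≢⇒< (proj₁ (bounds y∈)) (λ { refl → lo∉ y∈ }) , subst (y <_) (+-suc lo n) (proj₂ (bounds y∈)))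

module _ {A : Set} (p : A → Bool) where
  filterB-length-≥1 : ∀ xs {x} → x ∈ xs → T (p x) → 1 ≤ length (filterB p xs)
  filterB-length-≥1 (y ∷ xs) (here refl) t with p y
  ... | true = s≤s z≤n
  filterB-length-≥1 (y ∷ xs) (here refl) () | false
  filterB-length-≥1 (y ∷ xs) (there m) t with p y
  ... | true = s≤s z≤n
  ... | false = filterB-length-≥1 xs m t

  filterB-length-∷ : ∀ y xs → length (filterB p xs) ≤ length (filterB p (y ∷ xs))
  filterB-length-∷ y xs with p y
  ... | true = n≤1+n _
  ... | false = ≤-refl

  filterB-length-≥2 : ∀ xs {a b} → Unique xs → a ∈ xs → b ∈ xs → a ≢ b → T (p a) → T (p b) → 2 ≤ length (filterB p xs)
  filterB-length-≥2 (y ∷ xs) u (here refl) (here refl) ne pa pb = ⊥-elim (ne refl)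
  filterB-length-≥2 (y ∷ xs) u (here refl) (there mb) ne pa pb with p y
  ... | true = s≤s (filterB-length-≥1 xs mb pb)
  filterB-length-≥2 (y ∷ xs) u (here refl) (there mb) ne () pb | false
  filterB-length-≥2 (y ∷ xs) u (there ma) (here refl) ne pa pb with p y
  ... | true = s≤s (filterB-length-≥1 xs ma pa)
  filterB-length-≥2 (y ∷ xs) u (there ma) (here refl) ne pa () | false
  filterB-length-≥2 (y ∷ xs) (_ ∷ u) (there ma) (there mb) ne pa pb = ≤-trans (filterB-length-≥2 xs u ma mb ne pa pb) (filterB-length-∷ y xs)

  filterB-length-≥3 : ∀ xs {a b c} → Unique xs → a ∈ xs → b ∈ xs → c ∈ xs → a ≢ b → a ≢ c → b ≢ c → T (p a) → T (p b) → T (p c) → 3 ≤ length (filterB p xs)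
  filterB-length-≥3 (y ∷ xs) (_ ∷ u) (here refl) (here refl) mc ab ac bc pa pb pc = ⊥-elim (ab refl)
  filterB-length-≥3 (y ∷ xs) (_ ∷ u) (here refl) (there mb) (here refl) ab ac bc pa pb pc = ⊥-elim (ac refl)
  filterB-length-≥3 (y ∷ xs) (_ ∷ u) (there ma) (here refl) (here refl) ab ac bc pa pb pc = ⊥-elim (bc refl)
  filterB-length-≥3 (y ∷ xs) (_ ∷ u) (here refl) (there mb) (there mc) ab ac bc pa pb pc with p y
  ... | true = s≤s (filterB-length-≥2 xs u mb mc bc pb pc)
  filterB-length-≥3 (y ∷ xs) (_ ∷ u) (here refl) (there mb) (there mc) ab ac bc () pb pc | false
  filterB-length-≥3 (y ∷ xs) (_ ∷ u) (there ma) (here refl) (there mc) ab ac bc pa pb pc with p y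
  ... | true = s≤s (filterB-length-≥2 xs u ma mc ac pa pc)
  filterB-length-≥3 (y ∷ xs) (_ ∷ u) (there ma) (here refl) (there mc) ab ac bc pa () pc | false
  filterB-length-≥3 (y ∷ xs) (_ ∷ u) (there ma) (there mb) (here refl) ab ac bc pa pb pc with p y
  ... | true = s≤s (filterB-length-≥2 xs u ma mb ab pa pb)
  filterB-length-≥3 (y ∷ xs) (_ ∷ u) (there ma) (there mb) (here refl) ab ac bc pa pb () | false
  filterB-length-≥3 (y ∷ xs) (_ ∷ u) (there ma) (there mb) (there mc) ab ac bc pa pb pc = ≤-trans (filterB-length-≥3 xs u ma mb mc ab ac bc pa pb pc) (filterB-length-∷ y xs)

  filterB-length-≥2⁻ : ∀ xs → Unique xs → 2 ≤ length (filterB p xs) → ∃₂ λ a b → a ∈ xs × b ∈ xs × a ≢ b × T (p a) × T (p b)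
  filterB-length-≥2⁻ (y ∷ xs) (ay ∷ u) h with p y in e
  ... | true = let b , mb , pb = filterB-nonempty p xs (s≤s⁻¹ h) in y , b , here refl , there mb , All.lookup ay mb , ≡true⇒T e , pb
  ... | false = let a , b , ma , mb , ne , pa , pb = filterB-length-≥2⁻ xs u h in a , b , there ma , there mb , ne , pa , pb

  T-any⁺ : ∀ xs {x} → x ∈ xs → T (p x) → T (any p xs)
  T-any⁺ (y ∷ xs) (here refl) t = T-∨⁺ˡ t
  T-any⁺ (y ∷ xs) (there m) t = T-∨⁺ʳ {p y} (T-any⁺ xs m t)

  T-any⁻ : ∀ xs → T (any p xs) → ∃ λ x → x ∈ xs × T (p x)
  T-any⁻ (y ∷ xs) t with T-∨⁻ {p y} t
  ... | inj₁ t1 = y , here refl , t1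
  ... | inj₂ t2 = let x , m , t' = T-any⁻ xs t2 in x , there m , t'

==V-refl : ∀ v → T (v ==V v)
==V-refl (bd a)    = ≡ᵇ-refl a
==V-refl (yv a)    = ≡ᵇ-refl a
==V-refl (snk a b) = T-∧⁺ (≡ᵇ-refl a) (≡ᵇ-refl b)
==V-refl (src a b) = T-∧⁺ (≡ᵇ-refl a) (≡ᵇ-refl b)

==V-sound : ∀ u v → T (u ==V v) → u ≡ v
==V-sound (bd a)    (bd b)    t = cong bd (≡ᵇ⇒≡ a b t)
==V-sound (yv a)    (yv b)    t = cong yv (≡ᵇ⇒≡ a b t)
==V-sound (snk a b) (snk c d) t = let x , y = T-∧⁻ t in cong₂ snk (≡ᵇ⇒≡ a c x) (≡ᵇ⇒≡ b d y)
==V-sound (src a b) (src c d) t = let x , y = T-∧⁻ t in cong₂ src (≡ᵇ⇒≡ a c x) (≡ᵇ⇒≡ b d y)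

IsHead : V → Set
IsHead (yv _)    = ⊤
IsHead (snk _ _) = ⊤
IsHead _         = ⊥

yv-injective : ∀ {p q} → yv p ≡ yv q → p ≡ q
yv-injective refl = refl

IsHead⇒≢bd : ∀ {v} j → IsHead v → ¬ T (v ==V bd j)
IsHead⇒≢bd {yv _}    j _ ()
IsHead⇒≢bd {snk _ _} j _ ()

Touches : ℕ → V × V → Set
Touches j e = T (proj₁ e ==V bd j) ⊎ T (proj₂ e ==V bd j)

nbrOf-unique : ∀ nb es j u →
  (∀ {e} → e ∈ es → Touches j e → T (proj₁ e ==V bd j) × proj₂ e ≡ u) →
  (∃ λ e → e ∈ es × Touches j e) → nbrOf (mkWeb nb es) j ≡ just u
nbrOf-unique nb (e ∷ es) j u h ex with proj₁ e ==V bd j in e₁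
... | true = cong just (proj₂ (h (here refl) (inj₁ (≡true⇒T e₁))))
... | false with proj₂ e ==V bd j in e₂
...   | true = ⊥-elim (≡false⇒¬T e₁ (proj₁ (h (here refl) (inj₂ (≡true⇒T e₂)))))
...   | false with ex
...     | _ , here refl , inj₁ t = ⊥-elim (≡false⇒¬T e₁ t)
...     | _ , here refl , inj₂ t = ⊥-elim (≡false⇒¬T e₂ t)
...     | e′ , there e′∈ , t = nbrOf-unique nb es j u (h ∘′ there) (e′ , e′∈ , t)

OrientedAs : Sign → ℕ → V × V → Set
OrientedAs plus  j e = T (proj₁ e ==V bd j)
OrientedAs minus j e = ¬ T (proj₁ e ==V bd j)

signAt-unique : ∀ nb es j s →
  (∀ {e} → e ∈ es → Touches j e → OrientedAs s j e) →
  (∃ λ e → e ∈ es × Touches j e) → signAt (mkWeb nb es) j ≡ just s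
signAt-unique nb (e ∷ es) j s h ex with proj₁ e ==V bd j in e₁ | proj₂ e ==V bd j in e₂
signAt-unique nb (e ∷ es) j plus  h ex | true  | _    = refl
signAt-unique nb (e ∷ es) j minus h ex | true  | _    = ⊥-elim (h (here refl) (inj₁ (≡true⇒T e₁)) (≡true⇒T e₁))
signAt-unique nb (e ∷ es) j plus  h ex | false | true = ⊥-elim (≡false⇒¬T e₁ (h (here refl) (inj₂ (≡true⇒T e₂))))
signAt-unique nb (e ∷ es) j minus h ex | false | true = refl
signAt-unique nb (e ∷ es) j s h (_ , here refl , inj₁ t) | false | false = ⊥-elim (≡false⇒¬T e₁ t)
signAt-unique nb (e ∷ es) j s h (_ , here refl , inj₂ t) | false | false = ⊥-elim (≡false⇒¬T e₂ t)
signAt-unique nb (e ∷ es) j s h (e′ , there e′∈ , t) | false | false =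
  signAt-unique nb es j s (h ∘′ there) (e′ , e′∈ , t)

relabelBy : List (V × ℕ) → V → V
relabelBy vs v = foldr (λ p acc → if proj₁ p ==V v then bd (proj₂ p) else acc) v vs

relabelBy-fixed : ∀ vs v → (∀ {p} → p ∈ vs → ¬ T (proj₁ p ==V v)) → relabelBy vs v ≡ v
relabelBy-fixed [] v h = refl
relabelBy-fixed (p ∷ vs) v h with proj₁ p ==V v in e
... | true = ⊥-elim (h (here refl) (≡true⇒T e))
... | false = relabelBy-fixed vs v (λ m → h (there m))

relabelBy-cases : ∀ vs v → relabelBy vs v ≡ v ⊎ (∃ λ p → p ∈ vs × relabelBy vs v ≡ bd (proj₂ p))
relabelBy-cases [] v = inj₁ refl
relabelBy-cases (p ∷ vs) v with proj₁ p ==V v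
... | true = inj₂ (p , here refl , refl)
... | false with relabelBy-cases vs v
...   | inj₁ e = inj₁ e
...   | inj₂ (q , m , e) = inj₂ (q , there m , e)

relabelBy-hit : ∀ vs v i → (∀ {p} → p ∈ vs → T (proj₁ p ==V v) → proj₂ p ≡ i) → (∃ λ p → p ∈ vs × T (proj₁ p ==V v)) → relabelBy vs v ≡ bd i
relabelBy-hit (p ∷ vs) v i h ex with proj₁ p ==V v in e
... | true = cong bd (h (here refl) (≡true⇒T e))
... | false with ex
...   | q , here refl , t = ⊥-elim (≡false⇒¬T e t)
...   | q , there m , t = relabelBy-hit vs v i (λ m' → h (there m')) (q , m , t)

firstHead : List (V × V) → V
firstHead []      = bd 0
firstHead (e ∷ _) = proj₂ e

module LeftArc (rights : List (ℕ × ℕ)) (a b : ℕ) where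

  crossings : List (ℕ × ℕ)
  crossings = filterB (crosses (a , b)) rights

  before : ℕ × ℕ → ℕ × ℕ → Bool
  before R R′ = ltX (crossX (a , b) R) (crossX (a , b) R′)

  edge-cases : ∀ {e} → e ∈ leftArcEdges rights (a , b) →
    e ≡ (bd a , firstHead (leftArcEdges rights (a , b))) ⊎
    (∃ λ R → R ∈ crossings × proj₁ e ≡ src b (proj₁ R) × (filterB (before R) crossings ≡ [] → proj₂ e ≡ yv b))
  edge-cases (here refl) = inj₁ refl
  edge-cases (there e∈) with ∈-map⁻ _ e∈
  ... | R , R∈ , refl with filterB (before R) crossings in eq
  ...   | []    = inj₂ (R , R∈ , refl , λ _ → refl)
  ...   | _ ∷ _ = inj₂ (R , R∈ , refl , λ none → case trans (sym none) eq of λ ())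

  edge-head : ∀ {e} → e ∈ leftArcEdges rights (a , b) → IsHead (proj₂ e)
  edge-head (here refl) with selectMin before crossings
  ... | nothing = _
  ... | just _  = _
  edge-head (there e∈) with ∈-map⁻ _ e∈
  ... | R , _ , refl with selectMin before (filterB (before R) crossings)
  ...   | nothing = _
  ...   | just _  = _

  firstHead-no-crossing : crossings ≡ [] → firstHead (leftArcEdges rights (a , b)) ≡ yv b
  firstHead-no-crossing eq with crossings | eq
  ... | .[] | refl = refl

  firstHead-first-crossing : ∀ {R} → selectMin before crossings ≡ just R →
                             firstHead (leftArcEdges rights (a , b)) ≡ snk b (proj₁ R)
  firstHead-first-crossing eq with selectMin before crossings | eq
  ... | .(just _) | refl = refl

  positiveDen-crossX : ∀ {R} → R ∈ crossings → PositiveDen (crossX (a , b) R)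
  positiveDen-crossX {c , d} R∈ = crossX-positiveDen {a} {b} {c} {d} (proj₂ (∈-filterB⁻ (crosses (a , b)) rights R∈))

  before-trans : ∀ {R₁ R₂ R₃} → R₁ ∈ crossings → R₂ ∈ crossings → R₃ ∈ crossings →
                 T (before R₁ R₂) → T (before R₂ R₃) → T (before R₁ R₃)
  before-trans R₁∈ R₂∈ R₃∈ =
    ltX-trans (positiveDen-crossX R₁∈) (positiveDen-crossX R₂∈) (positiveDen-crossX R₃∈)

  last-edge : (∀ {c d d′} → (c , d) ∈ rights → (c , d′) ∈ rights → d ≡ d′) →
    ∀ {R₀} → R₀ ∈ crossings → ∃ λ e → e ∈ leftArcEdges rights (a , b) × proj₂ e ≡ yv b × (∃ λ c → proj₁ e ≡ src b c)
  last-edge functional R₀∈ =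
    from-last (∃-maximal before crossings R₀∈ before-trans (λ {R} _ → ltX-irrefl {crossX (a , b) R}))
    where
    from-last : (∃ λ R → R ∈ crossings × (∀ {R′} → R′ ∈ crossings → ¬ T (before R R′))) →
                ∃ λ e → e ∈ leftArcEdges rights (a , b) × proj₂ e ≡ yv b × (∃ λ c → proj₁ e ≡ src b c)
    from-last ((c , d) , R∈ , R-last) with edge-cases (there (∈-map⁺ _ R∈))
    ... | inj₂ ((.c , d′) , R′∈ , refl , into-Y)
      with refl ← functional (proj₁ (∈-filterB⁻ _ rights R∈)) (proj₁ (∈-filterB⁻ _ rights R′∈)) =
      _ , there (∈-map⁺ _ R∈) , into-Y (filterB-none (before (c , d)) crossings R-last) , c , refl

module RightArc (lefts : List (ℕ × ℕ)) (c d : ℕ) where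

  crossings : List (ℕ × ℕ)
  crossings = filterB (λ L → crosses L (c , d)) lefts

  before : ℕ × ℕ → ℕ × ℕ → Bool
  before L L′ = ltX (crossX L′ (c , d)) (crossX L (c , d))

  edge-cases : ∀ {e} → e ∈ rightArcEdges lefts (c , d) →
    e ≡ (bd d , firstHead (rightArcEdges lefts (c , d))) ⊎
    (∃ λ L → L ∈ crossings × proj₁ e ≡ src (proj₂ L) c × (filterB (before L) crossings ≡ [] → proj₂ e ≡ yv c))
  edge-cases (here refl) = inj₁ refl
  edge-cases (there e∈) with ∈-map⁻ _ e∈
  ... | L , L∈ , refl with filterB (before L) crossings in eq
  ...   | []    = inj₂ (L , L∈ , refl , λ _ → refl)
  ...   | _ ∷ _ = inj₂ (L , L∈ , refl , λ none → case trans (sym none) eq of λ ())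

  edge-head : ∀ {e} → e ∈ rightArcEdges lefts (c , d) → IsHead (proj₂ e)
  edge-head (here refl) with selectMin before crossings
  ... | nothing = _
  ... | just _  = _
  edge-head (there e∈) with ∈-map⁻ _ e∈
  ... | L , _ , refl with selectMin before (filterB (before L) crossings)
  ...   | nothing = _
  ...   | just _  = _

  firstHead-no-crossing : crossings ≡ [] → firstHead (rightArcEdges lefts (c , d)) ≡ yv c
  firstHead-no-crossing eq with crossings | eq
  ... | .[] | refl = refl

  firstHead-first-crossing : ∀ {L} → selectMin before crossings ≡ just L →
                             firstHead (rightArcEdges lefts (c , d)) ≡ snk (proj₂ L) c
  firstHead-first-crossing eq with selectMin before crossings | eq
  ... | .(just _) | refl = refl

  positiveDen-crossX : ∀ {L} → L ∈ crossings → PositiveDen (crossX L (c , d))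
  positiveDen-crossX {a , b} L∈ = crossX-positiveDen {a} {b} {c} {d} (proj₂ (∈-filterB⁻ (λ L → crosses L (c , d)) lefts L∈))

  before-trans : ∀ {L₁ L₂ L₃} → L₁ ∈ crossings → L₂ ∈ crossings → L₃ ∈ crossings →
                 T (before L₁ L₂) → T (before L₂ L₃) → T (before L₁ L₃)
  before-trans L₁∈ L₂∈ L₃∈ t u =
    ltX-trans (positiveDen-crossX L₃∈) (positiveDen-crossX L₂∈) (positiveDen-crossX L₁∈) u t

  last-edge : (∀ {a a′ b} → (a , b) ∈ lefts → (a′ , b) ∈ lefts → a ≡ a′) →
    ∀ {L₀} → L₀ ∈ crossings → ∃ λ e → e ∈ rightArcEdges lefts (c , d) × proj₂ e ≡ yv c × (∃ λ b → proj₁ e ≡ src b c)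
  last-edge injective L₀∈ =
    from-last (∃-maximal before crossings L₀∈ before-trans (λ {L} _ → ltX-irrefl {crossX L (c , d)}))
    where
    from-last : (∃ λ L → L ∈ crossings × (∀ {L′} → L′ ∈ crossings → ¬ T (before L L′))) →
                ∃ λ e → e ∈ rightArcEdges lefts (c , d) × proj₂ e ≡ yv c × (∃ λ b → proj₁ e ≡ src b c)
    from-last ((a , b) , L∈ , L-last) with edge-cases (there (∈-map⁺ _ L∈))
    ... | inj₂ ((a′ , .b) , L′∈ , refl , into-Y)
      with refl ← injective (proj₁ (∈-filterB⁻ _ lefts L∈)) (proj₁ (∈-filterB⁻ _ lefts L′∈)) =
      _ , there (∈-map⁺ _ L∈) , into-Y (filterB-none (before (a , b)) crossings L-last) , b , refl

2[1+i]∸1≡1+2i : ∀ i' → 2 * suc i' ∸ 1 ≡ suc (2 * i')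
2[1+i]∸1≡1+2i i' = +-suc i' (i' + 0)

2i≡1+[2i∸1] : ∀ i → 1 ≤ i → 2 * i ≡ suc (2 * i ∸ 1)
2i≡1+[2i∸1] (suc i') _ = trans (*-suc 2 i') (cong suc (sym (2[1+i]∸1≡1+2i i')))

2i≢2j∸1 : ∀ i j → 1 ≤ j → 2 * i ≢ 2 * j ∸ 1
2i≢2j∸1 i (suc j') _ e = even≢odd i j' (trans e (2[1+i]∸1≡1+2i j'))

2*-injective : ∀ i j → 2 * i ≡ 2 * j → i ≡ j
2*-injective i j e = *-cancelˡ-≡ i j 2 e

2*∸1-injective : ∀ i j → 1 ≤ i → 1 ≤ j → 2 * i ∸ 1 ≡ 2 * j ∸ 1 → i ≡ j
2*∸1-injective i j hi hj e = 2*-injective i j (trans (2i≡1+[2i∸1] i hi) (trans (cong suc e) (sym (2i≡1+[2i∸1] j hj))))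

2*-<-2*∸1 : ∀ {v w} → v < w → 2 * v < 2 * w ∸ 1
2*-<-2*∸1 {v} {w} lt = subst (_≤ 2 * w ∸ 1) (2[1+i]∸1≡1+2i v) (∸-monoˡ-≤ 1 (*-monoʳ-≤ 2 lt))

halve : ∀ k x → 1 ≤ x → x ≤ 2 * k → ∃ λ i → 1 ≤ i × i ≤ k × (x ≡ 2 * i ∸ 1 ⊎ x ≡ 2 * i)
halve zero x h1 h2 = ⊥-elim (<⇒≱ h1 h2)
halve (suc k) x h1 h2 with x ≤? 2 * k
... | yes le = let i , a , b , c = halve k x h1 le in i , a , m≤n⇒m≤1+n b , c
... | no nle with m≤n⇒m<n∨m≡n (subst (x ≤_) (*-suc 2 k) h2)
...   | inj₂ refl = suc k , s≤s z≤n , ≤-refl , inj₂ (sym (*-suc 2 k))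
...   | inj₁ lt with ≤-antisym (s≤s⁻¹ lt) (≰⇒> nle)
...     | refl = suc k , s≤s z≤n , ≤-refl , inj₁ (sym (trans (cong (_∸ 1) (*-suc 2 k)) refl))


PairRows : List ℕ → List ℕ → List ℕ → ℕ → ℕ → Set
PairRows T M B o e = (o ∈ T × e ∈ M) ⊎ (o ∈ M × e ∈ B) ⊎ (o ∈ T × e ∈ B)

-- The rows of a standard tableau of shape (n,n,n) with entries 1, …, N in
-- which, for i ≤ k, the entry 2i lies in a lower row than 2i-1.
record Rows (N k : ℕ) (Top Mid Bot : List ℕ) : Set where
  field
    increasing-top : Increasing Top
    increasing-mid : Increasing Mid
    increasing-bot : Increasing Bot
    length-top-mid : length Top ≡ length Mid
    length-mid-bot : length Mid ≡ length Bot
    top∩mid        : ∀ {x} → x ∈ Top → x ∈ Mid → ⊥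
    top∩bot        : ∀ {x} → x ∈ Top → x ∈ Bot → ⊥
    mid∩bot        : ∀ {x} → x ∈ Mid → x ∈ Bot → ⊥
    covers         : ∀ x → 1 ≤ x → x ≤ N → x ∈ Top ⊎ x ∈ Mid ⊎ x ∈ Bot
    positive-top   : ∀ {x} → x ∈ Top → 1 ≤ x
    positive-bot   : ∀ {x} → x ∈ Bot → 1 ≤ x
    2k≤N           : 2 * k ≤ N
    pairs          : ∀ i → 1 ≤ i → i ≤ k → PairRows Top Mid Bot (2 * i ∸ 1) (2 * i)

module WebOfRows (N k : ℕ) (Top Mid Bot : List ℕ) (lefts rights : List (ℕ × ℕ))
  (eL : matchArcs Top Mid ≡ just lefts) (eR : matchArcs Mid Bot ≡ just rights)
  (rows : Rows N k Top Mid Bot) where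

  open Rows rows

  unique-top : Unique Top
  unique-top = AllPairs.map <⇒≢ increasing-top

  k+k≡2*k : k + k ≡ 2 * k
  k+k≡2*k = cong (k +_) (sym (+-identityʳ k))

  k≤N : k ≤ N
  k≤N = ≤-trans (m≤m+n k k) (≤-trans (≤-reflexive k+k≡2*k) 2k≤N)

  unique-mid : Unique Mid
  unique-mid = AllPairs.map <⇒≢ increasing-mid

  left∈ : ∀ {i j} → (i , j) ∈ lefts → i ∈ Top × j ∈ Mid × i < j
  left∈ = matchArcs-∈ Top Mid eL
  left-into : ∀ {j} → j ∈ Mid → ∃ λ i → (i , j) ∈ lefts
  left-into = matchArcs-covers-targets Top Mid eL
  left-from : ∀ {i} → i ∈ Top → ∃ λ j → (i , j) ∈ lefts
  left-from = matchArcs-covers-sources Top Mid eL unique-top length-top-mid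
  left-functional : ∀ {i j j'} → (i , j) ∈ lefts → (i , j') ∈ lefts → j ≡ j'
  left-functional = matchArcs-functional Top Mid eL
  left-injective : ∀ {i i' j} → (i , j) ∈ lefts → (i' , j) ∈ lefts → i ≡ i'
  left-injective = matchArcs-injective Top Mid eL increasing-mid
  left-noncrossing : ∀ {i j i' j'} → (i , j) ∈ lefts → (i' , j') ∈ lefts → i < i' → i' < j → j < j' → ⊥
  left-noncrossing = matchArcs-noncrossing Top Mid eL increasing-mid

  right∈ : ∀ {i j} → (i , j) ∈ rights → i ∈ Mid × j ∈ Bot × i < j
  right∈ = matchArcs-∈ Mid Bot eR
  right-into : ∀ {j} → j ∈ Bot → ∃ λ i → (i , j) ∈ rights
  right-into = matchArcs-covers-targets Mid Bot eR
  right-from : ∀ {i} → i ∈ Mid → ∃ λ j → (i , j) ∈ rights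
  right-from = matchArcs-covers-sources Mid Bot eR unique-mid length-mid-bot
  right-functional : ∀ {i j j'} → (i , j) ∈ rights → (i , j') ∈ rights → j ≡ j'
  right-functional = matchArcs-functional Mid Bot eR
  right-injective : ∀ {i i' j} → (i , j) ∈ rights → (i' , j) ∈ rights → i ≡ i'
  right-injective = matchArcs-injective Mid Bot eR increasing-bot
  right-noncrossing : ∀ {i j i' j'} → (i , j) ∈ rights → (i' , j') ∈ rights → i < i' → i' < j → j < j' → ⊥
  right-noncrossing = matchArcs-noncrossing Mid Bot eR increasing-bot

  crossingEdges : ℕ × ℕ → List (V × V)
  crossingEdges L = map (λ R → (src (proj₂ L) (proj₁ R) , snk (proj₂ L) (proj₁ R))) (filterB (crosses L) rights)

  webEdges : List (V × V)
  webEdges = map (λ j → (bd j , yv j)) Mid ++ concatMap (leftArcEdges rights) lefts ++ concatMap (rightArcEdges lefts) rights ++ concatMap crossingEdges lefts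

  leftHead : ℕ → ℕ → V
  leftHead a b = firstHead (leftArcEdges rights (a , b))
  rightHead : ℕ → ℕ → V
  rightHead c d = firstHead (rightArcEdges lefts (c , d))

  data EdgeOrigin (e : V × V) : Set where
    fromY : ∀ {j} → j ∈ Mid → e ≡ (bd j , yv j) → EdgeOrigin e
    fromLeft : ∀ {a b} → (a , b) ∈ lefts → e ∈ leftArcEdges rights (a , b) → EdgeOrigin e
    fromRight : ∀ {c d} → (c , d) ∈ rights → e ∈ rightArcEdges lefts (c , d) → EdgeOrigin e
    fromCrossing : ∀ {L R} → L ∈ lefts → R ∈ filterB (crosses L) rights → e ≡ (src (proj₂ L) (proj₁ R) , snk (proj₂ L) (proj₁ R)) → EdgeOrigin e

  edge-origin : ∀ {e} → e ∈ webEdges → EdgeOrigin e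
  edge-origin {e} m with ∈-++⁻ (map (λ j → (bd j , yv j)) Mid) m
  ... | inj₁ m1 = let j , mj , eq = ∈-map⁻ _ m1 in fromY mj eq
  ... | inj₂ m2 with ∈-++⁻ (concatMap (leftArcEdges rights) lefts) m2
  ...   | inj₁ m3 = let (a , b) , mL , m' = find (∈-concatMap⁻ (leftArcEdges rights) {lefts} m3) in fromLeft mL m'
  ...   | inj₂ m4 with ∈-++⁻ (concatMap (rightArcEdges lefts) rights) m4
  ...     | inj₁ m5 = let (c , d) , mR , m' = find (∈-concatMap⁻ (rightArcEdges lefts) {rights} m5) in fromRight mR m'
  ...     | inj₂ m6 = let L , mL , m' = find (∈-concatMap⁻ crossingEdges {lefts} m6)
                          R , mR , eq = ∈-map⁻ _ m' in fromCrossing mL mR eq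

  Y-edge∈ : ∀ {x} → x ∈ Mid → (bd x , yv x) ∈ webEdges
  Y-edge∈ m = ∈-++⁺ˡ (∈-map⁺ _ m)
  leftArc-edge∈ : ∀ {a b e} → (a , b) ∈ lefts → e ∈ leftArcEdges rights (a , b) → e ∈ webEdges
  leftArc-edge∈ m me = ∈-++⁺ʳ (map (λ j → (bd j , yv j)) Mid) (∈-++⁺ˡ (∈-concatMap⁺ (leftArcEdges rights) (lose m me)))
  rightArc-edge∈ : ∀ {c d e} → (c , d) ∈ rights → e ∈ rightArcEdges lefts (c , d) → e ∈ webEdges
  rightArc-edge∈ m me = ∈-++⁺ʳ (map (λ j → (bd j , yv j)) Mid) (∈-++⁺ʳ (concatMap (leftArcEdges rights) lefts) (∈-++⁺ˡ (∈-concatMap⁺ (rightArcEdges lefts) (lose m me))))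
  crossing-edge∈ : ∀ {a b c d} → (a , b) ∈ lefts → (c , d) ∈ rights → T (crosses (a , b) (c , d)) → (src b c , snk b c) ∈ webEdges
  crossing-edge∈ {a} {b} mL mR t = ∈-++⁺ʳ (map (λ j → (bd j , yv j)) Mid) (∈-++⁺ʳ (concatMap (leftArcEdges rights) lefts)
     (∈-++⁺ʳ (concatMap (rightArcEdges lefts) rights)
       (∈-concatMap⁺ crossingEdges (lose mL (∈-map⁺ _ (∈-filterB⁺ (crosses (a , b)) rights mR t))))))

  edge-head : ∀ {e} → e ∈ webEdges → IsHead (proj₂ e)
  edge-head m with edge-origin m
  ... | fromY _ refl = tt
  ... | fromLeft {a} {b} _ me = LeftArc.edge-head rights a b me
  ... | fromRight {c} {d} _ me = RightArc.edge-head lefts c d me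
  ... | fromCrossing _ _ refl = tt

  data BoundaryEdge (x : ℕ) (e : V × V) : Set where
    atMid : x ∈ Mid → proj₂ e ≡ yv x → BoundaryEdge x e
    atTop : ∀ {b} → (x , b) ∈ lefts → proj₂ e ≡ leftHead x b → BoundaryEdge x e
    atBot : ∀ {c} → (c , x) ∈ rights → proj₂ e ≡ rightHead c x → BoundaryEdge x e

  edge-tail : ∀ {e} → e ∈ webEdges → (∃ λ x → proj₁ e ≡ bd x × BoundaryEdge x e) ⊎ (∃₂ λ b c → proj₁ e ≡ src b c)
  edge-tail m with edge-origin m
  ... | fromY mj refl = inj₁ (_ , refl , atMid mj refl)
  ... | fromLeft {a} {b} mL me with LeftArc.edge-cases rights a b me
  ...   | inj₁ refl = inj₁ (a , refl , atTop mL refl)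
  ...   | inj₂ ((c , _) , _ , eq , _) = inj₂ (b , c , eq)
  edge-tail m | fromRight {c} {d} mR me with RightArc.edge-cases lefts c d me
  ...   | inj₁ refl = inj₁ (d , refl , atBot mR refl)
  ...   | inj₂ ((_ , b) , _ , eq , _) = inj₂ (b , c , eq)
  edge-tail m | fromCrossing _ _ refl = inj₂ (_ , _ , refl)

  boundary-edge : ∀ {e x} → e ∈ webEdges → proj₁ e ≡ bd x → BoundaryEdge x e
  boundary-edge m eq with edge-tail m
  ... | inj₁ (x , eq' , be) with trans (sym eq') eq
  ...   | refl = be
  boundary-edge m eq | inj₂ (b , c , eq') with trans (sym eq') eq
  ... | ()

  OnlyNeighbour : ℕ → V → Set
  OnlyNeighbour x u = (∀ {e} → e ∈ webEdges → proj₁ e ≡ bd x → proj₂ e ≡ u) × (∃ λ e → e ∈ webEdges × proj₁ e ≡ bd x)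

  onlyNeighbour-mid : ∀ {x} → x ∈ Mid → OnlyNeighbour x (yv x)
  onlyNeighbour-mid {x} mx = (λ m eq → f (boundary-edge m eq)) , (_ , Y-edge∈ mx , refl)
    where
    f : ∀ {e} → BoundaryEdge x e → proj₂ e ≡ yv x
    f (atMid _ eq) = eq
    f (atTop mL _) = ⊥-elim (top∩mid (proj₁ (left∈ mL)) mx)
    f (atBot mR _) = ⊥-elim (mid∩bot mx (proj₁ (proj₂ (right∈ mR))))

  onlyNeighbour-top : ∀ {x b} → (x , b) ∈ lefts → OnlyNeighbour x (leftHead x b)
  onlyNeighbour-top {x} {b} mb = (λ m eq → f (boundary-edge m eq)) , (_ , leftArc-edge∈ mb (here refl) , refl)
    where
    f : ∀ {e} → BoundaryEdge x e → proj₂ e ≡ leftHead x b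
    f (atMid mx _) = ⊥-elim (top∩mid (proj₁ (left∈ mb)) mx)
    f (atTop mL eq) with left-functional mL mb
    ... | refl = eq
    f (atBot mR _) = ⊥-elim (top∩bot (proj₁ (left∈ mb)) (proj₁ (proj₂ (right∈ mR))))

  onlyNeighbour-bot : ∀ {c x} → (c , x) ∈ rights → OnlyNeighbour x (rightHead c x)
  onlyNeighbour-bot {c} {x} mc = (λ m eq → f (boundary-edge m eq)) , (_ , rightArc-edge∈ mc (here refl) , refl)
    where
    f : ∀ {e} → BoundaryEdge x e → proj₂ e ≡ rightHead c x
    f (atMid mx _) = ⊥-elim (mid∩bot mx (proj₁ (proj₂ (right∈ mc))))
    f (atTop mL _) = ⊥-elim (top∩bot (proj₁ (left∈ mL)) (proj₁ (proj₂ (right∈ mc))))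
    f (atBot mR eq) with right-injective mR mc
    ... | refl = eq

  nbrOf-onlyNeighbour : ∀ {x u} → OnlyNeighbour x u → nbrOf (mkWeb N webEdges) x ≡ just u
  nbrOf-onlyNeighbour {x} {u} (h , e , me , eq) =
    nbrOf-unique N webEdges x u
      (λ {e} m t → [ (λ t1 → t1 , h m (==V-sound _ _ t1)) , (λ t2 → ⊥-elim (IsHead⇒≢bd x (edge-head m) t2)) ]′ t)
      (e , me , inj₁ (subst (λ z → T (z ==V bd x)) (sym eq) (==V-refl (bd x))))

  adjacent-top-mid : ∀ {o} → o ∈ Top → suc o ∈ Mid → (o , suc o) ∈ lefts
  adjacent-top-mid {o} mo me with left-into me
  ... | x , mx with x ≟ o
  ...   | yes refl = mx
  ...   | no ne with left-from mo
  ...     | b , mb with suc o ≟ b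
  ...       | yes refl = ⊥-elim (ne (left-injective mx mb))
  ...       | no ne2 = ⊥-elim (left-noncrossing mx mb (≤∧≢⇒< (s≤s⁻¹ (proj₂ (proj₂ (left∈ mx)))) ne) (n<1+n o) (≤∧≢⇒< (proj₂ (proj₂ (left∈ mb))) ne2))

  adjacent-mid-bot : ∀ {o} → o ∈ Mid → suc o ∈ Bot → (o , suc o) ∈ rights
  adjacent-mid-bot {o} mo me with right-into me
  ... | x , mx with x ≟ o
  ...   | yes refl = mx
  ...   | no ne with right-from mo
  ...     | b , mb with suc o ≟ b
  ...       | yes refl = ⊥-elim (ne (right-injective mx mb))
  ...       | no ne2 = ⊥-elim (right-noncrossing mx mb (≤∧≢⇒< (s≤s⁻¹ (proj₂ (proj₂ (right∈ mx)))) ne) (n<1+n o) (≤∧≢⇒< (proj₂ (proj₂ (right∈ mb))) ne2))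

  adjacent-top-bot : ∀ {o} → o ∈ Top → suc o ∈ Bot → ∃₂ λ b c → (o , b) ∈ lefts × (c , suc o) ∈ rights × c < o × suc o < b
  adjacent-top-bot {o} mo me with left-from mo | right-into me
  ... | b , mb | c , mc =
    b , c , mb , mc ,
    ≤∧≢⇒< (s≤s⁻¹ (proj₂ (proj₂ (right∈ mc)))) (λ { refl → top∩mid mo (proj₁ (right∈ mc)) }) ,
    ≤∧≢⇒< (proj₂ (proj₂ (left∈ mb))) (λ { refl → mid∩bot (proj₁ (proj₂ (left∈ mb))) me })

  leftHead-short : ∀ o → leftHead o (suc o) ≡ yv (suc o)
  leftHead-short o = LeftArc.firstHead-no-crossing rights o (suc o) (filterB-none (λ R → crosses (o , suc o) R) rights (λ {R} _ → ¬crosses-shortˡ {o} {proj₁ R} {proj₂ R}))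

  rightHead-short : ∀ c → rightHead c (suc c) ≡ yv c
  rightHead-short c = RightArc.firstHead-no-crossing lefts c (suc c) (filterB-none (λ L → crosses L (c , suc c)) lefts (λ {L} _ → ¬crosses-shortʳ {proj₁ L} {proj₂ L} {c}))

  module TopBotPair {o b c} (mb : (o , b) ∈ lefts) (mc : (c , suc o) ∈ rights) (co : c < o) (ob : suc o < b) where
    leftHead-first-crossing : leftHead o b ≡ snk b c
    leftHead-first-crossing = LeftArc.firstHead-first-crossing rights o b (selectMin-least (LeftArc.before rights o b) (LeftArc.crossings rights o b) (∈-filterB⁺ (λ R → crosses (o , b) R) rights mc (crosses⁺ co ≤-refl ob)) f)
      where
      f : ∀ {y} → y ∈ LeftArc.crossings rights o b → y ≡ (c , suc o) ⊎ (T (LeftArc.before rights o b (c , suc o) y) × ¬ T (LeftArc.before rights o b y (c , suc o)))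
      f {c' , d'} my with ∈-filterB⁻ (λ R → crosses (o , b) R) rights my
      ... | my' , t with crosses⁻ {o} {b} {c'} {d'} t
      ...   | inj₁ (h1 , h2 , h3) =
        let lt1 = ltX-along-left-arc-separated {o} {b} {c} {c'} {d'} co (≤∧≢⇒< h1 (λ { refl → mid∩bot (proj₁ (right∈ my')) (proj₁ (proj₂ (right∈ mc))) })) h2 h3
        in inj₂ (lt1 , ltX-asym {crossX (o , b) (c , suc o)} {crossX (o , b) (c' , d')} lt1)
      ...   | inj₂ (h1 , h2 , h3) with d' ≟ suc o
      ...     | yes refl with right-injective my' mc
      ...       | refl = inj₁ refl
      f {c' , d'} my | my' , t | inj₂ (h1 , h2 , h3) | no ne with <-cmp c' c
      ...       | tri≈ _ refl _ = ⊥-elim (ne (right-functional my' mc))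
      ...       | tri> _ _ cc' = ⊥-elim (right-noncrossing mc my' cc' (<-trans h1 (n<1+n o)) (≤∧≢⇒< h2 (λ e → ne (sym e))))
      ...       | tri< c'c _ _ =
        let lt1 = ltX-along-left-arc-nested {o} {b} {c} {c'} {d'} c'c co (≤∧≢⇒< h2 (λ e → ne (sym e))) h3
        in inj₂ (lt1 , ltX-asym {crossX (o , b) (c , suc o)} {crossX (o , b) (c' , d')} lt1)

    rightHead-first-crossing : rightHead c (suc o) ≡ snk b c
    rightHead-first-crossing = RightArc.firstHead-first-crossing lefts c (suc o) (selectMin-least (RightArc.before lefts c (suc o)) (RightArc.crossings lefts c (suc o)) (∈-filterB⁺ (λ L → crosses L (c , suc o)) lefts mb (crosses⁺ co ≤-refl ob)) f)
      where
      f : ∀ {y} → y ∈ RightArc.crossings lefts c (suc o) → y ≡ (o , b) ⊎ (T (RightArc.before lefts c (suc o) (o , b) y) × ¬ T (RightArc.before lefts c (suc o) y (o , b)))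
      f {a' , b'} my with ∈-filterB⁻ (λ L → crosses L (c , suc o)) lefts my
      ... | my' , t with crosses⁻ {a'} {b'} {c} {suc o} t
      ...   | inj₁ (h1 , h2 , h3) =
        let lt1 = ltX-along-right-arc-separated {o} {b} {c} {a'} {b'} h1 h2 (≤∧≢⇒< (s≤s⁻¹ h3) (λ { refl → top∩mid (proj₁ (left∈ mb)) (proj₁ (proj₂ (left∈ my'))) })) ob
        in inj₂ (lt1 , ltX-asym {crossX (a' , b') (c , suc o)} {crossX (o , b) (c , suc o)} lt1)
      ...   | inj₂ (h1 , h2 , h3) with a' ≟ o
      ...     | yes refl with left-functional my' mb
      ...       | refl = inj₁ refl
      f {a' , b'} my | my' , t | inj₂ (h1 , h2 , h3) | no ne with <-cmp b' b
      ...       | tri≈ _ refl _ = ⊥-elim (ne (left-injective my' mb))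
      ...       | tri< b'b _ _ = ⊥-elim (left-noncrossing my' mb (≤∧≢⇒< (s≤s⁻¹ h2) ne) (<-trans (n<1+n o) h3) b'b)
      ...       | tri> _ _ bb' =
        let lt1 = ltX-along-right-arc-nested {o} {b} {c} {a'} {b'} h1 (≤∧≢⇒< (s≤s⁻¹ h2) ne) ob bb'
        in inj₂ (lt1 , ltX-asym {crossX (a' , b') (c , suc o)} {crossX (o , b) (c , suc o)} lt1)

  Survives : V → Set
  Survives (bd x) = 2 * k < x
  Survives (src _ _) = ⊤
  Survives _ = ⊥

  EntersFromSurvivor : V → Set
  EntersFromSurvivor v = ∃ λ e → e ∈ webEdges × proj₂ e ≡ v × Survives (proj₁ e)

  PairVertexShape : V → ℕ → Set
  PairVertexShape v o = v ≡ yv (suc o) ⊎ v ≡ yv o ⊎ (∃₂ λ b c → v ≡ snk b c × (o , b) ∈ lefts)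

  CommonNeighbour : V → ℕ → Set
  CommonNeighbour v o = OnlyNeighbour o v × OnlyNeighbour (suc o) v × PairVertexShape v o

  pairRows : ∀ i → 1 ≤ i → i ≤ k → PairRows Top Mid Bot (2 * i ∸ 1) (suc (2 * i ∸ 1))
  pairRows i hi hik = subst (PairRows Top Mid Bot (2 * i ∸ 1)) (2i≡1+[2i∸1] i hi) (pairs i hi hik)

  deleted-pair : ∀ {x} → 1 ≤ x → x ≤ 2 * k → ∃ λ i → 1 ≤ i × ((x ≡ 2 * i ∸ 1) ⊎ (x ≡ suc (2 * i ∸ 1))) × PairRows Top Mid Bot (2 * i ∸ 1) (suc (2 * i ∸ 1))
  deleted-pair {x} h1 h2 with halve k x h1 h2
  ... | i , hi , hik , inj₁ e = i , hi , inj₁ e , pairRows i hi hik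
  ... | i , hi , hik , inj₂ e = i , hi , inj₂ (trans e (2i≡1+[2i∸1] i hi)) , pairRows i hi hik

  -- The other edge into the Y-vertex comes from the source of the last crossing
  -- of its arc, or from the far end of that arc, which no pair deletes.
  entersFromSurvivor-top-mid : ∀ i → 1 ≤ i → (2 * i ∸ 1) ∈ Top → suc (2 * i ∸ 1) ∈ Mid → EntersFromSurvivor (yv (suc (2 * i ∸ 1)))
  entersFromSurvivor-top-mid i hi mo me with right-from me
  ... | d , md with RightArc.crossings lefts (suc (2 * i ∸ 1)) d in eq
  ...   | x ∷ xs = let e , me' , h , b , t = RightArc.last-edge lefts (suc (2 * i ∸ 1)) d left-injective (subst (x ∈_) (sym eq) (here refl))
                   in e , rightArc-edge∈ md me' , h , subst Survives (sym t) tt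
  ...   | [] = _ , rightArc-edge∈ md (here refl) , RightArc.firstHead-no-crossing lefts (suc (2 * i ∸ 1)) d eq , ≰⇒> bad
    where
    bad : ¬ d ≤ 2 * k
    bad le with deleted-pair {d} (positive-bot (proj₁ (proj₂ (right∈ md)))) le
    ... | i' , hi' , inj₁ refl , inj₁ (a1 , a2) = top∩bot a1 (proj₁ (proj₂ (right∈ md)))
    ... | i' , hi' , inj₂ refl , inj₁ (a1 , a2) = mid∩bot a2 (proj₁ (proj₂ (right∈ md)))
    ... | i' , hi' , inj₁ refl , inj₂ (inj₁ (a1 , a2)) = mid∩bot a1 (proj₁ (proj₂ (right∈ md)))
    ... | i' , hi' , inj₂ refl , inj₂ (inj₁ (a1 , a2)) =
      2i≢2j∸1 i i' hi' (trans (2i≡1+[2i∸1] i hi) (right-injective md (adjacent-mid-bot a1 a2)))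
    ... | i' , hi' , inj₁ refl , inj₂ (inj₂ (a1 , a2)) = top∩bot a1 (proj₁ (proj₂ (right∈ md)))
    ... | i' , hi' , inj₂ refl , inj₂ (inj₂ (a1 , a2)) with adjacent-top-bot a1 a2
    ...   | b' , c' , mb' , mc' , co' , ob' with right-injective md mc'
    ...     | refl with subst (λ l → (2 * i' ∸ 1 , b') ∈ l) eq
                          (∈-filterB⁺ (λ L → crosses L (suc (2 * i ∸ 1) , suc (2 * i' ∸ 1))) lefts mb' (crosses⁺ co' (n<1+n _) ob'))
    ...       | ()

  entersFromSurvivor-mid-bot : ∀ i → 1 ≤ i → (2 * i ∸ 1) ∈ Mid → suc (2 * i ∸ 1) ∈ Bot → EntersFromSurvivor (yv (2 * i ∸ 1))
  entersFromSurvivor-mid-bot i hi mo me with left-into mo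
  ... | a0 , ma with LeftArc.crossings rights a0 (2 * i ∸ 1) in eq
  ...   | x ∷ xs = let e , me' , h , c , t = LeftArc.last-edge rights a0 (2 * i ∸ 1) right-functional (subst (x ∈_) (sym eq) (here refl))
                   in e , leftArc-edge∈ ma me' , h , subst Survives (sym t) tt
  ...   | [] = _ , leftArc-edge∈ ma (here refl) , LeftArc.firstHead-no-crossing rights a0 (2 * i ∸ 1) eq , ≰⇒> bad
    where
    bad : ¬ a0 ≤ 2 * k
    bad le with deleted-pair {a0} (positive-top (proj₁ (left∈ ma))) le
    ... | i' , hi' , inj₂ refl , inj₁ (a1 , a2) = top∩mid (proj₁ (left∈ ma)) a2
    ... | i' , hi' , inj₂ refl , inj₂ (inj₁ (a1 , a2)) = top∩bot (proj₁ (left∈ ma)) a2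
    ... | i' , hi' , inj₂ refl , inj₂ (inj₂ (a1 , a2)) = top∩bot (proj₁ (left∈ ma)) a2
    ... | i' , hi' , inj₁ refl , inj₁ (a1 , a2) =
      2i≢2j∸1 i' i hi (trans (2i≡1+[2i∸1] i' hi') (sym (left-functional ma (adjacent-top-mid a1 a2))))
    ... | i' , hi' , inj₁ refl , inj₂ (inj₁ (a1 , a2)) = top∩mid (proj₁ (left∈ ma)) a1
    ... | i' , hi' , inj₁ refl , inj₂ (inj₂ (a1 , a2)) with adjacent-top-bot a1 a2
    ...   | b' , c' , mb' , mc' , co' , ob' with left-functional ma mb'
    ...     | refl with subst (λ l → (c' , suc (2 * i' ∸ 1)) ∈ l) eq
                          (∈-filterB⁺ (λ R → crosses (2 * i' ∸ 1 , 2 * i ∸ 1) R) rights mc' (crosses⁺ co' (n<1+n _) ob'))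
    ...       | ()

  pairVertex : ∀ i → 1 ≤ i → i ≤ k → ∃ λ v → CommonNeighbour v (2 * i ∸ 1) × EntersFromSurvivor v × IsHead v
  pairVertex i hi hik with pairRows i hi hik
  ... | inj₁ (mo , me) =
    yv (suc (2 * i ∸ 1)) , (subst (OnlyNeighbour (2 * i ∸ 1)) (leftHead-short (2 * i ∸ 1)) (onlyNeighbour-top (adjacent-top-mid mo me)) , onlyNeighbour-mid me , inj₁ refl) ,
    entersFromSurvivor-top-mid i hi mo me , tt
  ... | inj₂ (inj₁ (mo , me)) =
    yv (2 * i ∸ 1) , (onlyNeighbour-mid mo , subst (OnlyNeighbour (suc (2 * i ∸ 1))) (rightHead-short (2 * i ∸ 1)) (onlyNeighbour-bot (adjacent-mid-bot mo me)) , inj₂ (inj₁ refl)) ,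
    entersFromSurvivor-mid-bot i hi mo me , tt
  ... | inj₂ (inj₂ (mo , me)) with adjacent-top-bot mo me
  ...   | b , c , mb , mc , co , ob =
    snk b c , (subst (OnlyNeighbour (2 * i ∸ 1)) (TopBotPair.leftHead-first-crossing mb mc co ob) (onlyNeighbour-top mb) , subst (OnlyNeighbour (suc (2 * i ∸ 1))) (TopBotPair.rightHead-first-crossing mb mc co ob) (onlyNeighbour-bot mc) ,
               inj₂ (inj₂ (b , c , refl , mb))) ,
    (_ , crossing-edge∈ mb mc (crosses⁺ co (n<1+n _) ob) , refl , tt) , tt

  pairVertexShape-injective : ∀ {v} i j → 1 ≤ i → 1 ≤ j → PairVertexShape v (2 * i ∸ 1) → PairVertexShape v (2 * j ∸ 1) → i ≡ j
  pairVertexShape-injective i j hi hj (inj₁ refl) (inj₁ e) = 2*∸1-injective i j hi hj (suc-injective (yv-injective e))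
  pairVertexShape-injective i j hi hj (inj₁ refl) (inj₂ (inj₁ e)) = ⊥-elim (2i≢2j∸1 i j hj (trans (2i≡1+[2i∸1] i hi) (yv-injective e)))
  pairVertexShape-injective i j hi hj (inj₂ (inj₁ refl)) (inj₁ e) = ⊥-elim (2i≢2j∸1 j i hi (sym (trans (yv-injective e) (sym (2i≡1+[2i∸1] j hj)))))
  pairVertexShape-injective i j hi hj (inj₂ (inj₁ refl)) (inj₂ (inj₁ e)) = 2*∸1-injective i j hi hj (yv-injective e)
  pairVertexShape-injective i j hi hj (inj₂ (inj₂ (b , c , refl , mb))) (inj₂ (inj₂ (b' , c' , e , mb'))) with e
  ... | refl = 2*∸1-injective i j hi hj (left-injective mb mb')
  pairVertexShape-injective i j hi hj (inj₁ refl) (inj₂ (inj₂ (_ , _ , () , _)))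
  pairVertexShape-injective i j hi hj (inj₂ (inj₁ refl)) (inj₂ (inj₂ (_ , _ , () , _)))
  pairVertexShape-injective i j hi hj (inj₂ (inj₂ (_ , _ , refl , _))) (inj₁ ())
  pairVertexShape-injective i j hi hj (inj₂ (inj₂ (_ , _ , refl , _))) (inj₂ (inj₁ ()))

  web : Web
  web = mkWeb N webEdges

  internal-commonNbr : ∀ {v} → IsHead v → ((v ==V v) ∧ not (isBd v)) ≡ true
  internal-commonNbr {yv a} _ = T⇒≡true (T-∧⁺ (==V-refl (yv a)) tt)
  internal-commonNbr {snk a b} _ = T⇒≡true (T-∧⁺ (==V-refl (snk a b)) tt)

  commonNbr-pair : ∀ i → 1 ≤ i → i ≤ k → ∃ λ v → commonNbr web i ≡ just v × CommonNeighbour v (2 * i ∸ 1) × EntersFromSurvivor v × IsHead v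
  commonNbr-pair i hi hik with pairVertex i hi hik
  ... | v , cn@(n1 , n2 , kd) , te , hv =
    v , trans (>>=-just _ (nbrOf-onlyNeighbour n1)) (trans (>>=-just _ (subst (λ z → nbrOf web z ≡ just v) (sym (2i≡1+[2i∸1] i hi)) (nbrOf-onlyNeighbour n2)))
             (cong (λ b → if b then just v else nothing) (internal-commonNbr hv))) , cn , te , hv

  PairVertices : List (V × ℕ) → List ℕ → Set
  PairVertices [] [] = ⊤
  PairVertices (p ∷ ps) (i ∷ is) = proj₂ p ≡ i × CommonNeighbour (proj₁ p) (2 * i ∸ 1) × EntersFromSurvivor (proj₁ p) × IsHead (proj₁ p) × (1 ≤ i × i ≤ k) × PairVertices ps is
  PairVertices _ _ = ⊥

  commonNbrs-pairs : ∀ is → (∀ {i} → i ∈ is → 1 ≤ i × i ≤ k) → ∃ λ vs → commonNbrs web is ≡ just vs × PairVertices vs is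
  commonNbrs-pairs [] h = [] , refl , tt
  commonNbrs-pairs (i ∷ is) h with commonNbr-pair i (proj₁ (h (here refl))) (proj₂ (h (here refl))) | commonNbrs-pairs is (λ m → h (there m))
  ... | v , e1 , cn , te , hv | vs , e2 , vsp = (v , i) ∷ vs , trans (>>=-just _ e1) (trans (>>=-just _ e2) refl) , refl , cn , te , hv , h (here refl) , vsp

  module Contracted (vs : List (V × ℕ)) (is : List ℕ) (vsp : PairVertices vs is) where
    pairVertex-info : ∀ {p} → p ∈ vs → CommonNeighbour (proj₁ p) (2 * proj₂ p ∸ 1) × EntersFromSurvivor (proj₁ p) × IsHead (proj₁ p) × (1 ≤ proj₂ p × proj₂ p ≤ k)
    pairVertex-info = go vs is vsp
      where
      go : ∀ vs is → PairVertices vs is → ∀ {p} → p ∈ vs → CommonNeighbour (proj₁ p) (2 * proj₂ p ∸ 1) × EntersFromSurvivor (proj₁ p) × IsHead (proj₁ p) × (1 ≤ proj₂ p × proj₂ p ≤ k)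
      go (q ∷ qs) (i ∷ is) (refl , cn , te , hv , r , rest) (here refl) = cn , te , hv , r
      go (q ∷ qs) (i ∷ is) (_ , _ , _ , _ , _ , rest) (there m) = go qs is rest m

    relabel : V → V
    relabel (bd j) = bd (j ∸ k)
    relabel v = relabelBy vs v

    relabel-src : ∀ b c → relabelBy vs (src b c) ≡ src b c
    relabel-src b c = relabelBy-fixed vs (src b c) (λ {p} m t → case (==V-sound (proj₁ p) (src b c) t) of λ { refl → proj₁ (proj₂ (proj₂ (pairVertex-info m))) })

    relabel-pairVertex : ∀ {p} → p ∈ vs → relabelBy vs (proj₁ p) ≡ bd (proj₂ p)
    relabel-pairVertex {p} m = relabelBy-hit vs (proj₁ p) (proj₂ p)
      (λ {q} mq t → case (==V-sound (proj₁ q) (proj₁ p) t) of λ { refl →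
         let (_ , _ , k1) , _ , _ , (r1 , _) = pairVertex-info mq
             (_ , _ , k2) , _ , _ , (r2 , _) = pairVertex-info m
         in pairVertexShape-injective _ _ r1 r2 k1 k2 })
      (p , m , ==V-refl (proj₁ p))

    contracted : Web
    contracted = contract k vs web

    survives⁻ : ∀ {x} → T (not ((x ≤ᵇ 2 * k) ∨ false)) → 2 * k < x
    survives⁻ {x} t = ≰⇒> (λ le → T-not⁻ t (T-∨⁺ˡ (≤⇒≤ᵇ le)))

    contracted-edge⁻ : ∀ {e'} → e' ∈ edges contracted → ∃₂ λ x y → (x , y) ∈ webEdges × Survives x × IsHead y × e' ≡ (relabel x , relabel y)
    contracted-edge⁻ m with ∈-map⁻ _ m
    ... | (bd x , yv b) , me , refl = let me' , tg = ∈-filterB⁻ _ webEdges me in bd x , yv b , me' , survives⁻ tg , tt , refl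
    ... | (bd x , snk b c) , me , refl = let me' , tg = ∈-filterB⁻ _ webEdges me in bd x , snk b c , me' , survives⁻ tg , tt , refl
    ... | (src a b , yv c) , me , refl = let me' , tg = ∈-filterB⁻ _ webEdges me in src a b , yv c , me' , tt , tt , refl
    ... | (src a b , snk c d) , me , refl = let me' , tg = ∈-filterB⁻ _ webEdges me in src a b , snk c d , me' , tt , tt , refl
    ... | (yv a , y) , me , refl with edge-tail (proj₁ (∈-filterB⁻ _ webEdges me))
    ...   | inj₁ (_ , () , _)
    ...   | inj₂ (_ , _ , ())
    contracted-edge⁻ m | (snk a a' , y) , me , refl with edge-tail (proj₁ (∈-filterB⁻ _ webEdges me))
    ...   | inj₁ (_ , () , _)
    ...   | inj₂ (_ , _ , ())
    contracted-edge⁻ m | (x , bd a) , me , refl = ⊥-elim (edge-head (proj₁ (∈-filterB⁻ _ webEdges me)))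
    contracted-edge⁻ m | (x , src a b) , me , refl = ⊥-elim (edge-head (proj₁ (∈-filterB⁻ _ webEdges me)))

    survives⁺ : ∀ {x} → 2 * k < x → T (not ((x ≤ᵇ 2 * k) ∨ false))
    survives⁺ {x} lt = T-not⁺ (λ t → [ (λ t1 → <⇒≱ lt (≤ᵇ⇒≤ _ _ t1)) , (λ ()) ]′ (T-∨⁻ {x ≤ᵇ 2 * k} t))

    contracted-edge⁺ : ∀ {x y} → (x , y) ∈ webEdges → Survives x → IsHead y → (relabel x , relabel y) ∈ edges contracted
    contracted-edge⁺ {bd x} {yv b} me ok _ = ∈-map⁺ _ (∈-filterB⁺ _ webEdges me (survives⁺ ok))
    contracted-edge⁺ {bd x} {snk b c} me ok _ = ∈-map⁺ _ (∈-filterB⁺ _ webEdges me (survives⁺ ok))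
    contracted-edge⁺ {src a b} {yv c} me ok _ = ∈-map⁺ _ (∈-filterB⁺ _ webEdges me tt)
    contracted-edge⁺ {src a b} {snk c d} me ok _ = ∈-map⁺ _ (∈-filterB⁺ _ webEdges me tt)

    relabel-head : ∀ {v} → IsHead v → relabel v ≡ relabelBy vs v
    relabel-head {yv _} _ = refl
    relabel-head {snk _ _} _ = refl

    signAt-minus : ∀ j → 1 ≤ j → j ≤ k → (∃ λ p → p ∈ vs × proj₂ p ≡ j) → signAt contracted j ≡ just minus
    signAt-minus j hj hjk (p , mp , pj) = signAt-unique (N ∸ k) (edges contracted) j minus h ex
      where
      h : ∀ {e} → e ∈ edges contracted → Touches j e → OrientedAs minus j e
      h m _ with contracted-edge⁻ m
      ... | bd x , y , me , ok , hy , refl = λ t → <⇒≱ ok $ begin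
        x           ≤⟨ m≤n+m∸n x k ⟩
        k + (x ∸ k) ≡⟨ cong (k +_) (≡ᵇ⇒≡ (x ∸ k) j t) ⟩
        k + j       ≤⟨ +-monoʳ-≤ k hjk ⟩
        k + k       ≡⟨ k+k≡2*k ⟩
        2 * k       ∎
        where open ≤-Reasoning
      ... | src a b , y , me , ok , hy , refl = λ t → subst (λ z → ¬ T (z ==V bd j)) (sym (relabel-src a b)) (λ ()) t
      ex : ∃ λ e → e ∈ edges contracted × Touches j e
      ex with proj₁ (proj₂ (pairVertex-info mp))
      ... | (x0 , y0) , me , refl , ok =
        (relabel x0 , relabel y0) , contracted-edge⁺ me ok (edge-head me) ,
        inj₂ (subst (λ z → T (z ==V bd j)) (sym (trans (relabel-head (edge-head me)) (relabel-pairVertex mp))) (subst (λ z → T (bd z ==V bd j)) (sym pj) (==V-refl (bd j))))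

    signAt-plus : ∀ j → k < j → j ≤ N ∸ k → signAt contracted j ≡ just plus
    signAt-plus j kj jN = signAt-unique (N ∸ k) (edges contracted) j plus h ex
      where
      h : ∀ {e} → e ∈ edges contracted → Touches j e → OrientedAs plus j e
      h m (inj₁ t) = t
      h m (inj₂ t) with contracted-edge⁻ m
      ... | x , y , me , ok , hy , refl with relabelBy-cases vs y
      ...   | inj₁ eq = ⊥-elim (IsHead⇒≢bd j hy (subst (λ z → T (z ==V bd j)) (trans (relabel-head hy) eq) t))
      ...   | inj₂ (p , mp , eq) =
        ⊥-elim (<⇒≱ kj (subst (_≤ k) (≡ᵇ⇒≡ (proj₂ p) j (subst (λ z → T (z ==V bd j)) (trans (relabel-head hy) eq) t)) (proj₂ (proj₂ (proj₂ (proj₂ (pairVertex-info mp)))))))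
      x' : ℕ
      x' = j + k
      x'N : x' ≤ N
      x'N = subst (x' ≤_) (m∸n+n≡m k≤N) (+-monoˡ-≤ k jN)
      okx : 2 * k < x'
      okx = subst (_< x') k+k≡2*k (subst (k + k <_) (+-comm k j) (+-monoʳ-< k kj))
      nbx : ∃ λ u → OnlyNeighbour x' u
      nbx with covers x' (≤-trans (≤-trans (s≤s z≤n) kj) (m≤m+n j k)) x'N
      ... | inj₁ mt = let b , mb = left-from mt in _ , onlyNeighbour-top mb
      ... | inj₂ (inj₁ mm) = _ , onlyNeighbour-mid mm
      ... | inj₂ (inj₂ mb) = let c , mc = right-into mb in _ , onlyNeighbour-bot mc
      ex : ∃ λ e → e ∈ edges contracted × Touches j e
      ex with proj₂ (proj₂ nbx)
      ... | (x0 , y0) , me , refl =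
        (bd (x' ∸ k) , relabel y0) , contracted-edge⁺ me okx (edge-head me) ,
        inj₁ (subst (λ z → T (bd z ==V bd j)) (sym (m+n∸n≡m j k)) (==V-refl (bd j)))

  pairVertices-cover : ∀ vs is → PairVertices vs is → ∀ {j} → j ∈ is → ∃ λ p → p ∈ vs × proj₂ p ≡ j
  pairVertices-cover (p ∷ ps) (i ∷ is) (e , _) (here refl) = p , here refl , e
  pairVertices-cover (p ∷ ps) (i ∷ is) (_ , _ , _ , _ , _ , rest) (there m) = let q , mq , eq = pairVertices-cover ps is rest m in q , there mq , eq

  N∸k≡k+N∸2k : N ∸ k ≡ k + (N ∸ 2 * k)
  N∸k≡k+N∸2k with m≤n⇒∃[o]m+o≡n 2k≤N
  ... | r , refl = begin
    2 * k + r ∸ k       ≡⟨ cong (λ m → m + r ∸ k) (sym k+k≡2*k) ⟩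
    k + k + r ∸ k       ≡⟨ cong (_∸ k) (+-assoc k k r) ⟩
    k + (k + r) ∸ k     ≡⟨ m+n∸m≡n k (k + r) ⟩
    k + r               ≡⟨ cong (k +_) (sym (m+n∸m≡n (2 * k) r)) ⟩
    k + (2 * k + r ∸ 2 * k) ∎
    where open ≡-Reasoning

  boundarySigns-contracted : ∃ λ vs → commonNbrs web (range1 k) ≡ just vs × boundarySigns (contract k vs web) ≡ map just (replicate k minus ++ replicate (N ∸ 2 * k) plus)
  boundarySigns-contracted with commonNbrs-pairs (range1 k) (λ {i} m → let a , b = ∈-rangeFrom⁻ {1} {k} (subst (i ∈_) (range1≡rangeFrom k) m) in a , s≤s⁻¹ b)
  ... | vs , eq , vsp = vs , eq , bsig
    where
    open Contracted vs (range1 k) vsp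
    bsig : boundarySigns contracted ≡ map just (replicate k minus ++ replicate (N ∸ 2 * k) plus)
    bsig = begin
      map (signAt contracted) (range1 (N ∸ k))                      ≡⟨ cong (map (signAt contracted)) (range1≡rangeFrom (N ∸ k)) ⟩
      map (signAt contracted) (rangeFrom 1 (N ∸ k))                 ≡⟨ cong (map (signAt contracted) ∘′ rangeFrom 1) N∸k≡k+N∸2k ⟩
      map (signAt contracted) (rangeFrom 1 (k + (N ∸ 2 * k)))       ≡⟨ map-rangeFrom-split 1 k (N ∸ 2 * k) (signAt contracted) (just minus) (just plus)
                 (λ j a b → signAt-minus j a (s≤s⁻¹ b) (pairVertices-cover vs (range1 k) vsp (subst (j ∈_) (sym (range1≡rangeFrom k)) (∈-rangeFrom⁺ {1} {k} a b))))
                 (λ j a b → signAt-plus j a (subst (j ≤_) (sym N∸k≡k+N∸2k) (s≤s⁻¹ b))) ⟩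
      replicate k (just minus) ++ replicate (N ∸ 2 * k) (just plus)
        ≡⟨ sym (trans (map-++ just (replicate k minus) _) (cong₂ _++_ (map-replicate just k minus) (map-replicate just (N ∸ 2 * k) plus))) ⟩
      map just (replicate k minus ++ replicate (N ∸ 2 * k) plus) ∎
      where open ≡-Reasoning

record IsStandard (n : ℕ) (H : Tab3 n) : Set where
  field
    bounded            : ∀ r c → 1 ≤ H r c × H r c ≤ 3 * n
    injective          : ∀ r c r′ c′ → H r c ≡ H r′ c′ → r ≡ r′ × c ≡ c′
    surjective         : ∀ x → 1 ≤ x → x ≤ 3 * n → ∃₂ λ r c → H r c ≡ x
    rows-increasing    : ∀ r c c′ → toℕ c < toℕ c′ → H r c < H r c′
    columns-increasing : ∀ r r′ c → toℕ r < toℕ r′ → H r c < H r′ c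

Pointwise-map : ∀ {A : Set} {f g : A → ℕ} → (∀ x → f x < g x) → ∀ xs → Pointwise _<_ (map f xs) (map g xs)
Pointwise-map f<g []       = []
Pointwise-map f<g (x ∷ xs) = f<g x ∷ Pointwise-map f<g xs

PairsSplit : ℕ → (n : ℕ) → Tab3 n → Set
PairsSplit k n H = ∀ i → 1 ≤ i → i ≤ k →
  ∃ λ r → ∃ λ c → ∃ λ r′ → ∃ λ c′ → toℕ c < toℕ c′ × H r c ≡ 2 * i ∸ 1 × H r′ c′ ≡ 2 * i

module RowsOfTableau (n k : ℕ) (2k≤3n : 2 * k ≤ 3 * n) (H : Tab3 n) (std : IsStandard n H) (split : PairsSplit k n H) where

  open IsStandard std

  c₀ c₁ c₂ : Fin 3
  c₀ = Fin.zero
  c₁ = Fin.suc Fin.zero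
  c₂ = Fin.suc (Fin.suc Fin.zero)

  column : Fin 3 → List ℕ
  column c = map (λ r → H r c) (allFin n)

  top mid bot mids bots : List ℕ
  top = column c₀
  mid = column c₁
  bot = column c₂
  mids = filterB (λ j → memb j mid) (range1 (3 * n))
  bots = filterB (λ j → memb j bot) (range1 (3 * n))

  column-increasing : ∀ c → Increasing (column c)
  column-increasing c = AllPairs.map⁺ (AllPairs.tabulate⁺-< (columns-increasing _ _ c))

  ∈-column⁻ : ∀ {x c} → x ∈ column c → ∃ λ r → x ≡ H r c
  ∈-column⁻ m = let r , _ , e = ∈-map⁻ _ m in r , e

  ∈-column⁺ : ∀ r c → H r c ∈ column c
  ∈-column⁺ r c = ∈-map⁺ _ (∈-allFin r)

  length-column : ∀ c → length (column c) ≡ n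
  length-column c = trans (length-map (λ r → H r c) (allFin n)) (length-tabulate (λ i → i))

  column-bounded : ∀ {x c} → x ∈ column c → 1 ≤ x × x < 1 + 3 * n
  column-bounded m with ∈-column⁻ m
  ... | r , refl = proj₁ (bounded r _) , s≤s (proj₂ (bounded r _))

  mids≡mid : mids ≡ mid
  mids≡mid = trans (cong (filterB (λ j → memb j mid)) (range1≡rangeFrom (3 * n))) (filterB-memb-rangeFrom 1 (3 * n) mid (column-increasing c₁) column-bounded)

  bots≡bot : bots ≡ bot
  bots≡bot = trans (cong (filterB (λ j → memb j bot)) (range1≡rangeFrom (3 * n))) (filterB-memb-rangeFrom 1 (3 * n) bot (column-increasing c₂) column-bounded)

  columns-disjoint : ∀ {c c' x} → c ≢ c' → x ∈ column c → x ∈ column c' → ⊥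
  columns-disjoint ne m1 m2 with ∈-column⁻ m1 | ∈-column⁻ m2
  ... | r , refl | r' , e = ne (proj₂ (injective _ _ _ _ e))

  unique-top : Unique top
  unique-top = AllPairs.map <⇒≢ (column-increasing c₀)
  increasing-mids : Increasing mids
  increasing-mids = subst Increasing (sym mids≡mid) (column-increasing c₁)
  increasing-bots : Increasing bots
  increasing-bots = subst Increasing (sym bots≡bot) (column-increasing c₂)
  unique-mids : Unique mids
  unique-mids = AllPairs.map <⇒≢ increasing-mids

  length-top-mids : length top ≡ length mids
  length-top-mids = trans (length-column c₀) (sym (trans (cong length mids≡mid) (length-column c₁)))
  length-mids-bots : length mids ≡ length bots
  length-mids-bots = trans (trans (cong length mids≡mid) (length-column c₁)) (sym (trans (cong length bots≡bot) (length-column c₂)))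

  top∩mids : ∀ {x} → x ∈ top → x ∈ mids → ⊥
  top∩mids a b = columns-disjoint {c₀} {c₁} (λ ()) a (subst (_ ∈_) mids≡mid b)
  top∩bots : ∀ {x} → x ∈ top → x ∈ bots → ⊥
  top∩bots a b = columns-disjoint {c₀} {c₂} (λ ()) a (subst (_ ∈_) bots≡bot b)
  mids∩bots : ∀ {x} → x ∈ mids → x ∈ bots → ⊥
  mids∩bots a b = columns-disjoint {c₁} {c₂} (λ ()) (subst (_ ∈_) mids≡mid a) (subst (_ ∈_) bots≡bot b)

  covers : ∀ x → 1 ≤ x → x ≤ 3 * n → x ∈ top ⊎ x ∈ mids ⊎ x ∈ bots
  covers x h1 h2 with surjective x h1 h2
  ... | r , Fin.zero , refl = inj₁ (∈-column⁺ r c₀)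
  ... | r , Fin.suc Fin.zero , refl = inj₂ (inj₁ (subst (_ ∈_) (sym mids≡mid) (∈-column⁺ r c₁)))
  ... | r , Fin.suc (Fin.suc Fin.zero) , refl = inj₂ (inj₂ (subst (_ ∈_) (sym bots≡bot) (∈-column⁺ r c₂)))

  positive-top : ∀ {x} → x ∈ top → 1 ≤ x
  positive-top m = proj₁ (column-bounded m)
  positive-bots : ∀ {x} → x ∈ bots → 1 ≤ x
  positive-bots m = proj₁ (column-bounded (subst (_ ∈_) bots≡bot m))

  pairs : ∀ i → 1 ≤ i → i ≤ k → PairRows top mids bots (2 * i ∸ 1) (2 * i)
  pairs i hi hik with split i hi hik
  ... | r , Fin.zero , r' , Fin.suc Fin.zero , lt , e1 , e2 =
    inj₁ (subst (_∈ top) e1 (∈-column⁺ r c₀) , subst (_ ∈_) (sym mids≡mid) (subst (_∈ mid) e2 (∈-column⁺ r' c₁)))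
  ... | r , Fin.zero , r' , Fin.suc (Fin.suc Fin.zero) , lt , e1 , e2 =
    inj₂ (inj₂ (subst (_∈ top) e1 (∈-column⁺ r c₀) , subst (_ ∈_) (sym bots≡bot) (subst (_∈ bot) e2 (∈-column⁺ r' c₂))))
  ... | r , Fin.suc Fin.zero , r' , Fin.suc (Fin.suc Fin.zero) , lt , e1 , e2 =
    inj₂ (inj₁ (subst (_ ∈_) (sym mids≡mid) (subst (_∈ mid) e1 (∈-column⁺ r c₁)) , subst (_ ∈_) (sym bots≡bot) (subst (_∈ bot) e2 (∈-column⁺ r' c₂))))
  ... | r , Fin.zero , r' , Fin.zero , () , _ , _
  ... | r , Fin.suc Fin.zero , r' , Fin.zero , () , _ , _
  ... | r , Fin.suc Fin.zero , r' , Fin.suc Fin.zero , s≤s () , _ , _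
  ... | r , Fin.suc (Fin.suc Fin.zero) , r' , Fin.zero , () , _ , _
  ... | r , Fin.suc (Fin.suc Fin.zero) , r' , Fin.suc Fin.zero , s≤s () , _ , _
  ... | r , Fin.suc (Fin.suc Fin.zero) , r' , Fin.suc (Fin.suc Fin.zero) , s≤s (s≤s ()) , _ , _

  ballot-top-mids : Ballot 0 top mids
  ballot-top-mids = subst (Ballot 0 top) (sym mids≡mid) (Ballot-pointwise [] top mid (Pointwise-map (λ r → rows-increasing r c₀ c₁ (s≤s z≤n)) (allFin n)) (column-increasing c₁) [])
  ballot-mids-bots : Ballot 0 mids bots
  ballot-mids-bots = subst₂ (Ballot 0) (sym mids≡mid) (sym bots≡bot) (Ballot-pointwise [] mid bot (Pointwise-map (λ r → rows-increasing r c₁ c₂ (s≤s (s≤s z≤n))) (allFin n)) (column-increasing c₂) [])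

  rows : Rows (3 * n) k top mids bots
  rows = record
    { increasing-top = column-increasing c₀ ; increasing-mid = increasing-mids ; increasing-bot = increasing-bots
    ; length-top-mid = length-top-mids ; length-mid-bot = length-mids-bots
    ; top∩mid = top∩mids ; top∩bot = top∩bots ; mid∩bot = mids∩bots
    ; covers = covers ; positive-top = positive-top ; positive-bot = positive-bots
    ; 2k≤N = 2k≤3n ; pairs = pairs }

  leftArcs : ∃ λ lefts → matchArcs top mids ≡ just lefts
  leftArcs = matchArcs-defined top mids unique-top increasing-mids ballot-top-mids

  rightArcs : ∃ λ rights → matchArcs mids bots ≡ just rights
  rightArcs = matchArcs-defined mids bots unique-mids increasing-bots ballot-mids-bots

  open WebOfRows (3 * n) k top mids bots (proj₁ leftArcs) (proj₁ rightArcs) (proj₂ leftArcs) (proj₂ rightArcs) rows public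
    using (web; boundarySigns-contracted)

  -- Tymoczko's construction filters the middle row out of 1, …, 3n.
  wT≡web : wT n (conj H) ≡ just web
  wT≡web = trans (>>=-just _ (proj₂ leftArcs))
                 (>>=-just _ (subst (λ m → matchArcs m bots ≡ just (proj₁ rightArcs)) mids≡mid (proj₂ rightArcs)))

cells≡cartesianProduct : ∀ {n} xs (ys : List (Fin 3)) → concatMap (λ r → map (λ c → (r , c)) ys) xs ≡ List.cartesianProduct {A = Fin n} xs ys
cells≡cartesianProduct [] ys = refl
cells≡cartesianProduct (x ∷ xs) ys = cong (map (λ c → (x , c)) ys ++_) (cells≡cartesianProduct xs ys)

cells-unique : ∀ n → Unique (cells n)
cells-unique n = subst Unique (sym (cells≡cartesianProduct (allFin n) (allFin 3))) (cartesianProduct⁺ (allFin⁺ n) (allFin⁺ 3))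

∈-cells : ∀ {n} r c → (r , c) ∈ cells n
∈-cells r c = ∈-concatMap⁺ (λ r → map (λ c → (r , c)) (allFin 3)) (lose (∈-allFin r) (∈-map⁺ (λ c → (r , c)) (∈-allFin c)))

Cell : ℕ → Set
Cell n = Fin n × Fin 3

-- The relabelling is strictly monotone in the entry and numbers the two
-- occurrences of a repeated entry from left to right, so it is standard.
module TildeFilling (n k : ℕ) (2k≤3n : 2 * k ≤ 3 * n) (F : Tab3 n) (filling : IsFilling n k F) where

  open IsFilling filling

  entry : Cell n → ℕ
  entry x = F (proj₁ x) (proj₂ x)

  entryIs : ℕ → Cell n → Bool
  entryIs v rc = F (proj₁ rc) (proj₂ rc) ≡ᵇ v

  k+k≡2*k : k + k ≡ 2 * k
  k+k≡2*k = cong (k +_) (sym (+-identityʳ k))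

  2k<x⇒k<x∸k : ∀ {x} → 2 * k < x → k < x ∸ k
  2k<x⇒k<x∸k {x} 2k<x = m+n≤o⇒m≤o∸n (suc k) (subst (λ m → suc m ≤ x) (sym k+k≡2*k) 2k<x)

  k≤3n∸k : k ≤ 3 * n ∸ k
  k≤3n∸k = m+n≤o⇒m≤o∸n k (subst (_≤ 3 * n) (cong (λ z → k + z) (+-identityʳ k)) 2k≤3n)

  contentMult-pos : ∀ v → 1 ≤ contentMult n k v → 1 ≤ v × v ≤ 3 * n ∸ k
  contentMult-pos v h with (1 ≤ᵇ v) ∧ (v ≤ᵇ k) in e1
  ... | true = let a , b = T-∧⁻ {1 ≤ᵇ v} (≡true⇒T e1) in ≤ᵇ⇒≤ 1 v a , ≤-trans (≤ᵇ⇒≤ v k b) k≤3n∸k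
  ... | false with (k <ᵇ v) ∧ (v ≤ᵇ 3 * n ∸ k) in e2
  ...   | true = let a , b = T-∧⁻ {k <ᵇ v} (≡true⇒T e2) in ≤-trans (s≤s z≤n) (<ᵇ⇒< k v a) , ≤ᵇ⇒≤ v _ b
  contentMult-pos v () | false | false

  contentMult-twice⁻ : ∀ v → 2 ≤ contentMult n k v → 1 ≤ v × v ≤ k
  contentMult-twice⁻ v h with (1 ≤ᵇ v) ∧ (v ≤ᵇ k) in e1
  ... | true = let a , b = T-∧⁻ {1 ≤ᵇ v} (≡true⇒T e1) in ≤ᵇ⇒≤ 1 v a , ≤ᵇ⇒≤ v k b
  ... | false with (k <ᵇ v) ∧ (v ≤ᵇ 3 * n ∸ k)
  contentMult-twice⁻ v (s≤s ()) | false | true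
  contentMult-twice⁻ v () | false | false

  contentMult-≤2 : ∀ v → contentMult n k v ≤ 2
  contentMult-≤2 v with (1 ≤ᵇ v) ∧ (v ≤ᵇ k)
  ... | true = ≤-refl
  ... | false with (k <ᵇ v) ∧ (v ≤ᵇ 3 * n ∸ k)
  ...   | true = s≤s z≤n
  ...   | false = z≤n

  contentMult-twice : ∀ v → 1 ≤ v → v ≤ k → contentMult n k v ≡ 2
  contentMult-twice v h1 h2 rewrite T⇒≡true (T-∧⁺ {1 ≤ᵇ v} (≤⇒≤ᵇ h1) (≤⇒≤ᵇ h2)) = refl

  contentMult-once : ∀ v → k < v → v ≤ 3 * n ∸ k → contentMult n k v ≡ 1
  contentMult-once v h1 h2 with (1 ≤ᵇ v) ∧ (v ≤ᵇ k) in e1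
  ... | true = ⊥-elim (<⇒≱ h1 (≤ᵇ⇒≤ v k (proj₂ (T-∧⁻ {1 ≤ᵇ v} (≡true⇒T e1)))))
  ... | false rewrite T⇒≡true (T-∧⁺ {k <ᵇ v} (<⇒<ᵇ h1) (≤⇒≤ᵇ h2)) = refl

  entryIs-self : ∀ x → T (entryIs (entry x) x)
  entryIs-self x = ≡ᵇ-refl (entry x)

  entryIs-≡ : ∀ {x v} → entry x ≡ v → T (entryIs v x)
  entryIs-≡ {x} {v} e = ≡⇒≡ᵇ (entry x) v e

  entry-bounded : ∀ x → 1 ≤ entry x × entry x ≤ 3 * n ∸ k
  entry-bounded x = contentMult-pos (entry x) (subst (1 ≤_) (content (entry x)) (filterB-length-≥1 (entryIs (entry x)) (cells n) (∈-cells (proj₁ x) (proj₂ x)) (entryIs-self x)))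

  repeated-entry-≤k : ∀ {x y} → x ≢ y → entry x ≡ entry y → 1 ≤ entry x × entry x ≤ k
  repeated-entry-≤k {x} {y} ne e = contentMult-twice⁻ (entry x) (subst (2 ≤_) (content (entry x))
    (filterB-length-≥2 (entryIs (entry x)) (cells n) (cells-unique n) (∈-cells (proj₁ x) (proj₂ x)) (∈-cells (proj₁ y) (proj₂ y)) ne (entryIs-self x) (entryIs-≡ (sym e))))

  no-triple-entry : ∀ {x y z} → x ≢ y → x ≢ z → y ≢ z → entry x ≡ entry y → entry x ≡ entry z → ⊥
  no-triple-entry {x} {y} {z} xy xz yz e1 e2 = <⇒≱ (s≤s (s≤s (s≤s z≤n))) (≤-trans (subst (3 ≤_) (content (entry x))
    (filterB-length-≥3 (entryIs (entry x)) (cells n) (cells-unique n) (∈-cells (proj₁ x) (proj₂ x)) (∈-cells (proj₁ y) (proj₂ y)) (∈-cells (proj₁ z) (proj₂ z))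
       xy xz yz (entryIs-self x) (entryIs-≡ (sym e1)) (entryIs-≡ (sym e2)))) (contentMult-≤2 (entry x)))

  occurs-twice : ∀ v → 1 ≤ v → v ≤ k → ∃₂ λ x y → x ≢ y × entry x ≡ v × entry y ≡ v
  occurs-twice v h1 h2 with filterB-length-≥2⁻ (entryIs v) (cells n) (cells-unique n) (subst (2 ≤_) (sym (trans (content v) (contentMult-twice v h1 h2))) ≤-refl)
  ... | x , y , _ , _ , ne , px , py = x , y , ne , ≡ᵇ⇒≡ _ v px , ≡ᵇ⇒≡ _ v py

  occurs-once : ∀ v → k < v → v ≤ 3 * n ∸ k → ∃ λ x → entry x ≡ v
  occurs-once v h1 h2 with filterB-nonempty (entryIs v) (cells n) (subst (1 ≤_) (sym (trans (content v) (contentMult-once v h1 h2))) ≤-refl)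
  ... | x , _ , px = x , ≡ᵇ⇒≡ _ v px

  repeated-entry-columns : ∀ {x y} → x ≢ y → entry x ≡ entry y → proj₂ x ≢ proj₂ y
  repeated-entry-columns {r , c} {r' , .c} ne e refl with <-cmp (toℕ r) (toℕ r')
  ... | tri< lt _ _ = <-irrefl e (colsStrict r r' c lt)
  ... | tri≈ _ eq _ = ne (cong (_, c) (toℕ-injective eq))
  ... | tri> _ _ gt = <-irrefl (sym e) (colsStrict r' r c gt)

  repeatsRightOf : Cell n → Cell n → Bool
  repeatsRightOf x rc = (F (proj₁ rc) (proj₂ rc) ≡ᵇ entry x) ∧ (toℕ (proj₂ x) <ᵇ toℕ (proj₂ rc))

  tilde : Cell n → ℕ
  tilde x = tildeT k F (proj₁ x) (proj₂ x)

  tilde-once : ∀ x → k < entry x → tilde x ≡ entry x + k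
  tilde-once (r , c) lt with F r c ≤ᵇ k in e
  ... | true = ⊥-elim (<⇒≱ lt (≤ᵇ⇒≤ _ k (≡true⇒T e)))
  ... | false = refl

  tilde-left : ∀ x → entry x ≤ k → T (any (repeatsRightOf x) (cells n)) → tilde x ≡ 2 * entry x ∸ 1
  tilde-left (r , c) le t rewrite T⇒≡true (≤⇒≤ᵇ le) | T⇒≡true t = refl

  tilde-right : ∀ x → entry x ≤ k → ¬ T (any (repeatsRightOf x) (cells n)) → tilde x ≡ 2 * entry x
  tilde-right (r , c) le t rewrite T⇒≡true (≤⇒≤ᵇ le) | ¬T⇒≡false t = refl

  tilde-repeated : ∀ {x y} → x ≢ y → entry x ≡ entry y → toℕ (proj₂ x) < toℕ (proj₂ y) → tilde x ≡ 2 * entry x ∸ 1 × tilde y ≡ 2 * entry x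
  tilde-repeated {x} {y} ne e lt =
    tilde-left x le (T-any⁺ (repeatsRightOf x) (cells n) (∈-cells (proj₁ y) (proj₂ y)) (T-∧⁺ (≡⇒≡ᵇ _ _ (sym e)) (<⇒<ᵇ lt))) ,
    trans (tilde-right y (subst (_≤ k) e le) noz) (cong (2 *_) (sym e))
    where
    le : entry x ≤ k
    le = proj₂ (repeated-entry-≤k ne e)
    noz : ¬ T (any (repeatsRightOf y) (cells n))
    noz t with T-any⁻ (repeatsRightOf y) (cells n) t
    ... | z , _ , tz with T-∧⁻ {F (proj₁ z) (proj₂ z) ≡ᵇ entry y} tz
    ...   | t1 , t2 =
      let ez = ≡ᵇ⇒≡ _ _ t1
          lt2 = <ᵇ⇒< _ _ t2
      in no-triple-entry {x} {y} {z} ne (λ { refl → <-asym lt lt2 }) (λ { refl → <-irrefl refl lt2 }) e (trans e (sym ez))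

  tilde-cases : ∀ x → (entry x ≤ k × 2 * entry x ∸ 1 ≤ tilde x × tilde x ≤ 2 * entry x) ⊎ (k < entry x × tilde x ≡ entry x + k)
  tilde-cases x with entry x ≤? k
  ... | no nle = inj₂ (≰⇒> nle , tilde-once x (≰⇒> nle))
  ... | yes le with T? (any (repeatsRightOf x) (cells n))
  ...   | yes t = inj₁ (le , ≤-reflexive (sym (tilde-left x le t)) , subst (_≤ 2 * entry x) (sym (tilde-left x le t)) (m∸n≤m _ 1))
  ...   | no t = inj₁ (le , subst (2 * entry x ∸ 1 ≤_) (sym (tilde-right x le t)) (m∸n≤m _ 1) , ≤-reflexive (tilde-right x le t))

  tilde-mono : ∀ {x y} → entry x < entry y → tilde x < tilde y
  tilde-mono {x} {y} lt with tilde-cases x | tilde-cases y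
  ... | inj₁ (lx , _ , ux) | inj₁ (ly , dy , _) = ≤-<-trans ux (<-≤-trans (2*-<-2*∸1 lt) dy)
  ... | inj₁ (lx , _ , ux) | inj₂ (ky , ey) =
    subst (tilde x <_) (sym ey) (≤-<-trans ux (≤-<-trans (*-monoʳ-≤ 2 lx) (subst (_< entry y + k) (cong (λ z → k + z) (sym (+-identityʳ k))) (+-monoˡ-< k ky))))
  ... | inj₂ (kx , _) | inj₁ (ly , _ , _) = ⊥-elim (<-irrefl refl (≤-<-trans ly (<-trans kx lt)))
  ... | inj₂ (kx , ex) | inj₂ (ky , ey) = subst₂ _<_ (sym ex) (sym ey) (+-monoˡ-< k lt)

  H : Fin n → Fin 3 → ℕ
  H = tildeT k F

  2*∸1<2* : ∀ v → 1 ≤ v → 2 * v ∸ 1 < 2 * v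
  2*∸1<2* v h = subst (2 * v ∸ 1 <_) (sym (2i≡1+[2i∸1] v h)) ≤-refl

  tilde-repeated-ordered : ∀ {a b} → a ≢ b → entry a ≡ entry b →
    ∃₂ λ x y → toℕ (proj₂ x) < toℕ (proj₂ y) × tilde x ≡ 2 * entry a ∸ 1 × tilde y ≡ 2 * entry a
  tilde-repeated-ordered {a} {b} ne e with <-cmp (toℕ (proj₂ a)) (toℕ (proj₂ b))
  ... | tri< lt _ _ = a , b , lt , tilde-repeated ne e lt
  ... | tri≈ _ eq _ = ⊥-elim (repeated-entry-columns ne e (toℕ-injective eq))
  ... | tri> _ _ gt = let p , q = tilde-repeated (λ z → ne (sym z)) (sym e) gt in
    b , a , gt , trans p (cong (λ z → 2 * z ∸ 1) (sym e)) , trans q (cong (2 *_) (sym e))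

  tilde-bounded : ∀ r c → 1 ≤ H r c × H r c ≤ 3 * n
  tilde-bounded r c with entry-bounded (r , c) | tilde-cases (r , c)
  ... | v1 , v2 | inj₁ (le , lo , up) = ≤-trans (∸-monoˡ-≤ 1 (*-monoʳ-≤ 2 v1)) lo , ≤-trans up (≤-trans (*-monoʳ-≤ 2 le) 2k≤3n)
  ... | v1 , v2 | inj₂ (kx , e) =
    subst (1 ≤_) (sym e) (≤-trans v1 (m≤m+n _ k)) ,
    subst (_≤ 3 * n) (sym e) (≤-trans (+-monoˡ-≤ k v2) (≤-reflexive (m∸n+n≡m (≤-trans (m≤n+m k k) (subst (_≤ 3 * n) (cong (λ z → k + z) (+-identityʳ k)) 2k≤3n)))))

  tilde-injective : ∀ r c r' c' → H r c ≡ H r' c' → r ≡ r' × c ≡ c'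
  tilde-injective r c r' c' e with ≡-dec Fin._≟_ Fin._≟_ (r , c) (r' , c')
  ... | yes refl = refl , refl
  ... | no ne with <-cmp (entry (r , c)) (entry (r' , c'))
  ...   | tri< lt _ _ = ⊥-elim (<-irrefl e (tilde-mono {r , c} {r' , c'} lt))
  ...   | tri> _ _ gt = ⊥-elim (<-irrefl (sym e) (tilde-mono {r' , c'} {r , c} gt))
  ...   | tri≈ _ ev _ with <-cmp (toℕ c) (toℕ c')
  ...     | tri< lt _ _ = let p , q = tilde-repeated {r , c} {r' , c'} ne ev lt in
    ⊥-elim (<-irrefl (trans (sym p) (trans e q)) (2*∸1<2* _ (proj₁ (entry-bounded (r , c)))))
  ...     | tri≈ _ eq _ = ⊥-elim (repeated-entry-columns {r , c} {r' , c'} ne ev (toℕ-injective eq))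
  ...     | tri> _ _ gt = let p , q = tilde-repeated {r' , c'} {r , c} (λ z → ne (sym z)) (sym ev) gt in
    ⊥-elim (<-irrefl (trans (sym p) (trans (sym e) q)) (2*∸1<2* _ (proj₁ (entry-bounded (r' , c')))))

  tilde-rows : ∀ r c c' → toℕ c < toℕ c' → H r c < H r c'
  tilde-rows r c c' lt with m≤n⇒m<n∨m≡n (rowsWeak r c c' (<⇒≤ lt))
  ... | inj₁ vlt = tilde-mono {r , c} {r , c'} vlt
  ... | inj₂ ev = let p , q = tilde-repeated {r , c} {r , c'} (λ { refl → <-irrefl refl lt }) ev lt in
    subst₂ _<_ (sym p) (sym q) (2*∸1<2* _ (proj₁ (entry-bounded (r , c))))

  tilde-columns : ∀ r r' c → toℕ r < toℕ r' → H r c < H r' c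
  tilde-columns r r' c lt = tilde-mono {r , c} {r' , c} (colsStrict r r' c lt)

  tilde-split : ∀ i → 1 ≤ i → i ≤ k → ∃ λ r → ∃ λ c → ∃ λ r' → ∃ λ c' → toℕ c < toℕ c' × H r c ≡ 2 * i ∸ 1 × H r' c' ≡ 2 * i
  tilde-split i h1 h2 with occurs-twice i h1 h2
  ... | a , b , ne , va , vb with tilde-repeated-ordered ne (trans va (sym vb))
  ...   | (r , c) , (r' , c') , lt , ex , ey =
    r , c , r' , c' , lt , trans ex (cong (λ z → 2 * z ∸ 1) va) , trans ey (cong (2 *_) va)

  tilde-surjective : ∀ x → 1 ≤ x → x ≤ 3 * n → ∃₂ λ r c → H r c ≡ x
  tilde-surjective x h1 h2 with x ≤? 2 * k
  ... | yes le with halve k x h1 le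
  ...   | i , hi , hik , xe with tilde-split i hi hik
  ...     | r , c , r' , c' , lt , e1 , e2 with xe
  ...       | inj₁ refl = r , c , e1
  ...       | inj₂ refl = r' , c' , e2
  tilde-surjective x h1 h2 | no 2k≮x with occurs-once (x ∸ k) (2k<x⇒k<x∸k (≰⇒> 2k≮x)) (∸-monoˡ-≤ k h2)
  ... | (r , c) , ev =
    r , c , trans (tilde-once (r , c) (subst (k <_) (sym ev) (2k<x⇒k<x∸k (≰⇒> 2k≮x))))
                  (trans (cong (_+ k) ev) (m∸n+n≡m (≤-trans (m≤m+n k k) (≤-trans (≤-reflexive k+k≡2*k) (<⇒≤ (≰⇒> 2k≮x))))))

  isStandard : IsStandard n H
  isStandard = record
    { bounded = tilde-bounded ; injective = tilde-injective ; surjective = tilde-surjective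
    ; rows-increasing = tilde-rows ; columns-increasing = tilde-columns }

mainTheorem3 : (n k : ℕ) → 1 ≤ n → 2 * k ≤ 3 * n → (F : Tab3 n) → IsFilling n k F →
    ∃ λ (W : Web) → (wTs n k F ≡ just W) × (boundarySigns W ≡ map just (signStr n k))
mainTheorem3 n k _ 2k≤3n F filling = contract k vs web , wTs≡ , signs
  where
  open TildeFilling n k 2k≤3n F filling using (isStandard; tilde-split)
  open RowsOfTableau n k 2k≤3n (tildeT k F) isStandard tilde-split
  vs = proj₁ boundarySigns-contracted
  signs = proj₂ (proj₂ boundarySigns-contracted)
  wTs≡ : wTs n k F ≡ just (contract k vs web)
  wTs≡ = trans (>>=-just _ wT≡web) (>>=-just _ (proj₁ (proj₂ boundarySigns-contracted)))
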